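{- Let $q$ be a fixed odd prime. Let $B=\{b_1,b_2,\ldots,b_t\} \subset \mathbb{Z} \setminus \{0\}$ be a set of integers not containing a perfect $q^{th}$ power (a $q^{th}$ power of an integer), and assume that $B$ is $(r-1)$-dimensional. Then, for any choice of $r$ different primes $\overline{p}_1,\ldots,\overline{p}_r$, there exists a set $B^{\prime}$ that is geometrically $q$-equivalent to $B$ such that $\{\overline{p}_1,\ldots,\overline{p}_{r}\}$ is exactly the set of all prime numbers that divide at least one element of $B^{\prime}$.
   Context: Throughout, $q$ is a fixed odd prime and $\mathrm{PG}(\mathbb{F}_q^k)$ denotes the projective space over the field $\mathbb{F}_q$ defined by $\mathbb{F}_q^k$; $\mathrm{PGL}(k,q)$ is the projective general linear group acting on it. For a positive integer $b=\prod_{j} p_j^{a_j}$, its $q$-free part is $\mathrm{rad}_q(b)=\prod_j p_j^{a_j \bmod q}$, and for a finite set $B$ of nonzero integers, $\pi_q(B)=\{\mathrm{rad}_q(|b|) : b\in B\}$. Point set associated to $B$: let $p_1<\cdots<p_k$ be all distinct primes dividing some element of $\pi_q(B)$, and for each $b_j\in B$ let $\nu_{ij}\ge 0$ with $p_i^{\nu_{ij}} \,\|\, \mathrm{rad}_q(|b_j|)$. The point set of $B$ is $\{\langle(\nu_{1j},\ldots,\nu_{kj})\rangle_{\mathbb{F}_q}\}_j \subset \mathrm{PG}(\mathbb{F}_q^k)$. Dimension: $B$ is $d$-dimensional if this point set spans a $d$-dimensional projective subspace of $\mathrm{PG}(\mathbb{F}_q^k)$, where $k$ is the number of distinct primes dividing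 elements of $\pi_q(B)$. Geometric $q$-equivalence: two finite sets $B,B'$ of nonzero integers, neither containing a perfect $q^{th}$ power, are geometrically $q$-equivalent if, letting $p_1,\ldots,p_k$ be all primes dividing some element of $\pi_q(B)\cup\pi_q(B')$ and forming the point sets $\mathcal{S},\mathcal{S}'\subset\mathrm{PG}(\mathbb{F}_q^k)$ of exponent vectors (mod $q$) of the $q$-free parts of the elements of $B$ and $B'$ respectively with respect to these $k$ primes, there exists $\Psi\in\mathrm{PGL}(k,q)$ with $\Psi(\mathcal{S})=\mathcal{S}'$. -}

module Defs where

open import Data.Nat using (ℕ; zero; suc; _+_; _*_; _^_; _<_; _≤?_; NonZero)
open import Data.Nat.DivMod using (_%_)
open import Data.Nat.Divisibility using (_∣_; _∣?_; divides)
open import Data.Nat.Primality using (Prime; prime?)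
open import Data.Integer using (ℤ; ∣_∣)
open import Data.Fin using (Fin; zero; suc)
open import Data.List using (List; length; lookup; upTo; filter; map)
open import Data.Nat.ListAction using (product)
open import Data.List.Relation.Unary.Any using (Any)
open import Data.Product using (Σ; ∃; _×_)
open import Relation.Nullary using (¬_; yes; no)
open import Relation.Binary.PropositionalEquality using (_≡_; _≢_)
open import Function.Bundles using (_⇔_)

-- valAux fuel p n : number of times p divides n (fuel-bounded; fuel = n suffices)
valAux : ℕ → ℕ → ℕ → ℕ
valAux zero    p n = 0
valAux (suc f) p n with p ≤? 1 | n Data.Nat.≟ 0 | p ∣? n
... | yes _ | _     | _                  = 0
... | no _  | yes _ | _                  = 0
... | no _  | no _  | yes (divides k _)  = suc (valAux f p k)
... | no _  | no _  | no _               = 0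

val : ℕ → ℕ → ℕ
val p n = valAux n p n

primesUpTo : ℕ → List ℕ
primesUpTo n = filter prime? (upTo (suc n))

radq : (q : ℕ) .{{_ : NonZero q}} → ℕ → ℕ
radq q n = product (map (λ p → p ^ (val p n % q)) (primesUpTo n))

-- F_q-linear algebra on vectors Fin k → ℕ (entries read mod q)

infix 4 _≡[_]_

sumFin : (n : ℕ) → (Fin n → ℕ) → ℕ
sumFin zero  f = 0
sumFin (suc n) f = f zero + sumFin n (λ i → f (suc i))

_≡[_]_ : ℕ → (q : ℕ) .{{_ : NonZero q}} → ℕ → Set
a ≡[ q ] b = a % q ≡ b % q

Vect : ℕ → Set
Vect k = Fin k → ℕ

InSpan : (q : ℕ) .{{_ : NonZero q}} {k t : ℕ} → (Fin t → Vect k) → Vect k → Set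
InSpan q {k} {t} vs u =
  Σ (Fin t → ℕ) λ c → (i : Fin k) → u i ≡[ q ] sumFin t (λ j → c j * vs j i)

LinIndep : (q : ℕ) .{{_ : NonZero q}} {k r : ℕ} → (Fin r → Vect k) → Set
LinIndep q {k} {r} ws =
  (c : Fin r → ℕ) → ((i : Fin k) → sumFin r (λ l → c l * ws l i) ≡[ q ] 0) →
  (l : Fin r) → c l ≡[ q ] 0

SpanDim : (q : ℕ) .{{_ : NonZero q}} {k t : ℕ} → (Fin t → Vect k) → ℕ → Set
SpanDim q {k} {t} vs r =
  Σ (Fin r → Vect k) λ ws →
    LinIndep q ws ×
    ((l : Fin r) → InSpan q vs (ws l)) ×
    ((j : Fin t) → InSpan q ws (vs j))

_·_ : {k : ℕ} → (Fin k → Fin k → ℕ) → Vect k → Vect k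
_·_ {k} M v i = sumFin k (λ j → M i j * v j)

δ : {k : ℕ} → Fin k → Fin k → ℕ
δ zero    zero    = 1
δ zero    (suc _) = 0
δ (suc _) zero    = 0
δ (suc i) (suc j) = δ i j

Invertible : (q : ℕ) .{{_ : NonZero q}} {k : ℕ} → (Fin k → Fin k → ℕ) → Set
Invertible q {k} M =
  Σ (Fin k → Fin k → ℕ) λ N →
    ((i j : Fin k) → sumFin k (λ l → M i l * N l j) ≡[ q ] δ i j) ×
    ((i j : Fin k) → sumFin k (λ l → N i l * M l j) ≡[ q ] δ i j)

-- ⟨u⟩ = ⟨v⟩ as projective points: u = λ v for a nonzero scalar λ ∈ F_q
SamePoint : (q : ℕ) .{{_ : NonZero q}} {k : ℕ} → Vect k → Vect k → Set
SamePoint q {k} u v =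
  Σ ℕ λ λ' → ¬ (λ' ≡[ q ] 0) × ((i : Fin k) → u i ≡[ q ] λ' * v i)

-- Finite set of integers: a duplicate-free list
open import Data.List.Relation.Unary.Unique.Propositional using (Unique)
open import Data.List.Relation.Unary.All using (All)

DividesPiq : (q : ℕ) .{{_ : NonZero q}} → List ℤ → ℕ → Set
DividesPiq q B p = Any (λ b → p ∣ radq q (∣ b ∣)) B

-- ps = (p_1 < ... < p_k) is exactly the list of primes dividing
-- some element of π_q(B) ∪ π_q(B')   (use B' = [] for π_q(B) alone)
IsPrimeList : (q : ℕ) .{{_ : NonZero q}} → List ℤ → List ℤ → {k : ℕ} → (Fin k → ℕ) → Set
IsPrimeList q B B' {k} ps =
  ((i j : Fin k) → Data.Fin._<_ i j → ps i < ps j) ×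
  ((p : ℕ) → (Prime p × (DividesPiq q B p Data.Sum.⊎ DividesPiq q B' p)) ⇔ (∃ λ i → ps i ≡ p))
  where import Data.Sum

expVec : (q : ℕ) .{{_ : NonZero q}} {k : ℕ} → (Fin k → ℕ) → ℤ → Vect k
expVec q ps b i = val (ps i) (radq q (∣ b ∣))

pointsOf : (q : ℕ) .{{_ : NonZero q}} {k : ℕ} → (Fin k → ℕ) → (B : List ℤ) → Fin (length B) → Vect k
pointsOf q ps B j = expVec q ps (lookup B j)

-- B is (r - 1)-dimensional: the span of its point set is a projective
-- subspace of projective dimension r - 1, i.e. vector dimension r.
IsDimMinusOne : (q : ℕ) .{{_ : NonZero q}} → List ℤ → ℕ → Set
IsDimMinusOne q B r =
  Σ ℕ λ k → Σ (Fin k → ℕ) λ ps →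
    IsPrimeList q B Data.List.[] ps × SpanDim q (pointsOf q ps B) r

PerfectPower : ℕ → ℤ → Set
PerfectPower q b = Σ ℤ λ x → b ≡ x Data.Integer.^ q

Admissible : ℕ → List ℤ → Set
Admissible q B = Unique B × All (λ b → b ≢ Data.Integer.0ℤ) B × All (λ b → ¬ PerfectPower q b) B

GeomEquiv : (q : ℕ) .{{_ : NonZero q}} → List ℤ → List ℤ → Set
GeomEquiv q B B' =
  Admissible q B × Admissible q B' ×
  Σ ℕ λ k → Σ (Fin k → ℕ) λ ps → IsPrimeList q B B' ps ×
  Σ (Fin k → Fin k → ℕ) λ M → Invertible q M ×
    ((j : Fin (length B)) → ∃ λ j' → SamePoint q (M · pointsOf q ps B j) (pointsOf q ps B' j')) ×
    ((j' : Fin (length B')) → ∃ λ j → SamePoint q (M · pointsOf q ps B j) (pointsOf q ps B' j'))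

{-# OPTIONS --safe #-}
module Submission where

-- Take as coordinates the primes of π_q(B) together with p̄₁, …, p̄ᵣ. The exponent vectors vⱼ of B
-- span an r-dimensional subspace of F_q^k, so Gaussian elimination gives an invertible M sending a
-- basis of that span to the unit vectors at the p̄ₗ. Every M vⱼ is then supported on the p̄ₗ, and
-- B′ consists of the numbers b′ⱼ = ∏ᵢ pᵢ^((M vⱼ)ᵢ mod q). M maps the point set of B onto that of B′;
-- each p̄ₗ divides some b′ⱼ because the M vⱼ span the unit vector at p̄ₗ; and no b′ⱼ is a perfect
-- q-th power, since then vⱼ = 0 and bⱼ would be one (q being odd takes care of the sign).

open import Defs
open import Data.Nat using (ℕ; NonZero)
open import Data.Nat.Divisibility using (_∣_)
open import Data.Nat.Primality using (Prime)
open import Data.Integer using (ℤ; ∣_∣)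
open import Data.Fin using (Fin)
open import Data.List using (List)
open import Data.List.Relation.Unary.Any using (Any)
open import Data.Product using (Σ; ∃; _×_)
open import Relation.Nullary using (¬_)
open import Relation.Binary.PropositionalEquality using (_≡_)
open import Function.Definitions using (Injective)
open import Function.Bundles using (_⇔_)
open import Level using (0ℓ)
open import Function using (_∘_)
open import Function.Bundles using (mk⇔; Equivalence)
open import Data.Empty using (⊥-elim)
open import Data.Product using (_,_; proj₁; proj₂; ∃₂; map₂)
open import Data.Sum using (_⊎_; inj₁; inj₂; [_,_]; [_,_]′)
open import Relation.Nullary using (Dec; yes; no)
open import Relation.Nullary.Decidable using (¬?; _×-dec_; _⊎-dec_; decidable-stable; dec-true; dec-false)
open import Relation.Unary using (Decidable)
open import Relation.Binary.Bundles using (Setoid)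
open import Relation.Binary.Definitions using (tri<; tri≈; tri>)
import Relation.Binary.Construct.On as On
import Relation.Binary.Reasoning.Setoid as SetoidReasoning
open import Relation.Binary.PropositionalEquality
  using (_≢_; _≗_; refl; sym; trans; cong; cong₂; subst; module ≡-Reasoning)
import Relation.Binary.PropositionalEquality as ≡

open import Data.Nat using (zero; suc; _+_; _*_; _∸_; _^_; _<_; _≤_; _≤?_; _<?_; s≤s; z≤n; ≢-nonZero; nonTrivial⇒n>1)
open import Data.Nat.Properties
open import Data.Nat.DivMod
open import Data.Nat.Divisibility using (divides; _∣?_; ∣⇒≤; _∣0)
open import Data.Nat.Coprimality using (prime⇒coprime; coprime-Bézout)
open import Data.Nat.GCD using (module Bézout)
open import Data.Nat.Primality
  using (prime?; prime[2]; prime⇒nonZero; prime⇒nonTrivial; prime⇒irreducible; euclidsLemma; ¬prime[1])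
open import Data.Nat.Primality.Factorisation using (factorise)
open import Data.Nat.Induction using (<-rec)
open import Data.Nat.ListAction using (product; sum)
open import Data.Nat.ListAction.Properties using (sum-++)
open import Data.Nat.Tactic.RingSolver using (solve-∀)
import Algebra.Properties.Semiring.Sum +-*-semiring as ∑

open import Data.Integer using (-[1+_])
import Data.Integer as ℤ
import Data.Integer.Properties as ℤₚ
import Data.Integer.Tactic.RingSolver as ℤ-Solver

open import Data.Fin using (zero; suc)
import Data.Fin as Fin
import Data.Fin.Properties as Finₚ
open import Data.Fin.Permutation.Components using (transpose; transpose-inverse)

open import Data.List using ([]; _∷_; _++_; map; filter; upTo; length; lookup; tabulate; deduplicate)
open import Data.List.Properties using (map-++; upTo-∷ʳ)
open import Data.List.Membership.Propositional using (_∈_)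
open import Data.List.Membership.Propositional.Properties using (∈-lookup; ∈-filter⁺; ∈-filter⁻; ∈-upTo⁺)
open import Data.List.Relation.Unary.All using (All; []; _∷_)
import Data.List.Relation.Unary.All as All
import Data.List.Relation.Unary.All.Properties as Allₚ
import Data.List.Relation.Unary.Any as Any
import Data.List.Relation.Unary.Any.Properties as Anyₚ
open import Data.List.Relation.Unary.AllPairs using (AllPairs; _∷_)
open import Data.List.Relation.Unary.AllPairs.Properties using (applyUpTo⁺₁; filter⁺)
open import Data.List.Relation.Unary.Unique.Propositional using (Unique)
open import Data.List.Relation.Unary.Unique.DecPropositional.Properties using (deduplicate-!)

sumFin≡sum : ∀ n (f : Fin n → ℕ) → sumFin n f ≡ ∑.sum f
sumFin≡sum zero    f = refl
sumFin≡sum (suc n) f = cong (f zero +_) (sumFin≡sum n (f ∘ suc))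

sumFin-cong : ∀ n {f g : Fin n → ℕ} → f ≗ g → sumFin n f ≡ sumFin n g
sumFin-cong zero    f≗g = refl
sumFin-cong (suc n) f≗g = cong₂ _+_ (f≗g zero) (sumFin-cong n (f≗g ∘ suc))

sumFin-zero : ∀ n → sumFin n (λ _ → 0) ≡ 0
sumFin-zero zero    = refl
sumFin-zero (suc n) = sumFin-zero n

sumFin-+ : ∀ n (f g : Fin n → ℕ) → sumFin n (λ i → f i + g i) ≡ sumFin n f + sumFin n g
sumFin-+ n f g = begin
  sumFin n (λ i → f i + g i)  ≡⟨ sumFin≡sum n _ ⟩
  ∑.sum (λ i → f i + g i)     ≡⟨ ∑.∑-distrib-+ f g ⟩
  ∑.sum f + ∑.sum g           ≡⟨ cong₂ _+_ (sumFin≡sum n f) (sumFin≡sum n g) ⟨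
  sumFin n f + sumFin n g     ∎
  where open ≡-Reasoning

*-distribˡ-sumFin : ∀ n c (f : Fin n → ℕ) → c * sumFin n f ≡ sumFin n (λ i → c * f i)
*-distribˡ-sumFin n c f = begin
  c * sumFin n f            ≡⟨ cong (c *_) (sumFin≡sum n f) ⟩
  c * ∑.sum f               ≡⟨ ∑.*-distribˡ-sum c f ⟩
  ∑.sum (λ i → c * f i)     ≡⟨ sumFin≡sum n _ ⟨
  sumFin n (λ i → c * f i)  ∎
  where open ≡-Reasoning

sumFin-comm : ∀ m n (f : Fin m → Fin n → ℕ) →
  sumFin m (λ i → sumFin n (f i)) ≡ sumFin n (λ j → sumFin m (λ i → f i j))
sumFin-comm m n f = begin
  sumFin m (λ i → sumFin n (f i))             ≡⟨ sumFin-via-sum m n f ⟩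
  ∑.sum (λ i → ∑.sum (f i))                   ≡⟨ ∑.∑-comm f ⟩
  ∑.sum (λ j → ∑.sum (λ i → f i j))           ≡⟨ sumFin-via-sum n m (λ j i → f i j) ⟨
  sumFin n (λ j → sumFin m (λ i → f i j))     ∎
  where
  open ≡-Reasoning
  sumFin-via-sum : ∀ m n (g : Fin m → Fin n → ℕ) →
    sumFin m (λ i → sumFin n (g i)) ≡ ∑.sum (λ i → ∑.sum (g i))
  sumFin-via-sum m n g =
    trans (sumFin≡sum m _) (∑.sum-cong-≗ (λ i → sumFin≡sum n (g i)))

≤-sumFin : ∀ n (f : Fin n → ℕ) i → f i ≤ sumFin n f
≤-sumFin (suc n) f zero    = m≤m+n (f zero) _
≤-sumFin (suc n) f (suc i) = ≤-trans (≤-sumFin n (f ∘ suc) i) (m≤n+m _ (f zero))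

sumFin-*-vanishing : ∀ n (c g : Fin n → ℕ) → (∀ i → g i ≡ 0) → sumFin n (λ i → c i * g i) ≡ 0
sumFin-*-vanishing n c g g≡0 = trans (sumFin-cong n (λ i → trans (cong (c i *_) (g≡0 i)) (*-zeroʳ (c i))))
  (sumFin-zero n)

δ-refl : ∀ {k} (i : Fin k) → δ i i ≡ 1
δ-refl zero    = refl
δ-refl (suc i) = δ-refl i

δ-≢ : ∀ {k} {i j : Fin k} → i ≢ j → δ i j ≡ 0
δ-≢ {i = zero}  {zero}  i≢j = ⊥-elim (i≢j refl)
δ-≢ {i = zero}  {suc j} i≢j = refl
δ-≢ {i = suc i} {zero}  i≢j = refl
δ-≢ {i = suc i} {suc j} i≢j = δ-≢ (i≢j ∘ cong suc)

δ-sym : ∀ {k} (i j : Fin k) → δ i j ≡ δ j i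
δ-sym zero    zero    = refl
δ-sym zero    (suc j) = refl
δ-sym (suc i) zero    = refl
δ-sym (suc i) (suc j) = δ-sym i j

δ-injective : ∀ {k k′} {f : Fin k → Fin k′} → Injective _≡_ _≡_ f → ∀ a b → δ (f a) (f b) ≡ δ a b
δ-injective {f = f} f-inj a b with a Finₚ.≟ b
... | yes refl = trans (δ-refl (f a)) (sym (δ-refl a))
... | no a≢b   = trans (δ-≢ (a≢b ∘ f-inj)) (sym (δ-≢ a≢b))

sumFin-δˡ : ∀ n (i : Fin n) (v : Fin n → ℕ) → sumFin n (λ j → δ i j * v j) ≡ v i
sumFin-δˡ (suc n) zero    v = trans (cong (v zero + 0 +_) (sumFin-zero n))
  (trans (+-identityʳ _) (+-identityʳ (v zero)))
sumFin-δˡ (suc n) (suc i) v = sumFin-δˡ n i (v ∘ suc)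

sumFin-δʳ : ∀ n (i : Fin n) (v : Fin n → ℕ) → sumFin n (λ j → v j * δ i j) ≡ v i
sumFin-δʳ n i v = trans (sumFin-cong n (λ j → *-comm (v j) _)) (sumFin-δˡ n i v)

Matrix : ℕ → Set
Matrix k = Fin k → Fin k → ℕ

infixl 7 _⊗_
_⊗_ : ∀ {k} → Matrix k → Matrix k → Matrix k
_⊗_ {k} A B i j = sumFin k (λ l → A i l * B l j)

·-linear : ∀ {k t} (M : Matrix k) (c : Fin t → ℕ) (W : Fin t → Vect k) i →
  (M · (λ j → sumFin t (λ l → c l * W l j))) i ≡ sumFin t (λ l → c l * (M · W l) i)
·-linear {k} {t} M c W i = begin
  sumFin k (λ j → M i j * sumFin t (λ l → c l * W l j))
    ≡⟨ sumFin-cong k (λ j → *-distribˡ-sumFin t (M i j) _) ⟩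
  sumFin k (λ j → sumFin t (λ l → M i j * (c l * W l j)))
    ≡⟨ sumFin-comm k t _ ⟩
  sumFin t (λ l → sumFin k (λ j → M i j * (c l * W l j)))
    ≡⟨ sumFin-cong t (λ l → sumFin-cong k (λ j → x[yz]≡y[xz] (M i j) (c l) (W l j))) ⟩
  sumFin t (λ l → sumFin k (λ j → c l * (M i j * W l j)))
    ≡⟨ sumFin-cong t (λ l → *-distribˡ-sumFin k (c l) _) ⟨
  sumFin t (λ l → c l * sumFin k (λ j → M i j * W l j)) ∎
  where
  open ≡-Reasoning
  x[yz]≡y[xz] : ∀ x y z → x * (y * z) ≡ y * (x * z)
  x[yz]≡y[xz] = solve-∀

·-⊗ : ∀ {k} (A B : Matrix k) (v : Vect k) i → ((A ⊗ B) · v) i ≡ (A · (B · v)) i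
·-⊗ {k} A B v i = begin
  sumFin k (λ j → sumFin k (λ l → A i l * B l j) * v j)
    ≡⟨ sumFin-cong k (λ j → trans (*-comm _ (v j)) (*-distribˡ-sumFin k (v j) _)) ⟩
  sumFin k (λ j → sumFin k (λ l → v j * (A i l * B l j)))
    ≡⟨ sumFin-comm k k _ ⟩
  sumFin k (λ l → sumFin k (λ j → v j * (A i l * B l j)))
    ≡⟨ sumFin-cong k (λ l → sumFin-cong k (λ j → x[yz]≡y[zx] (v j) (A i l) (B l j))) ⟩
  sumFin k (λ l → sumFin k (λ j → A i l * (B l j * v j)))
    ≡⟨ sumFin-cong k (λ l → *-distribˡ-sumFin k (A i l) _) ⟨
  sumFin k (λ l → A i l * sumFin k (λ j → B l j * v j)) ∎
  where
  open ≡-Reasoning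
  x[yz]≡y[zx] : ∀ x y z → x * (y * z) ≡ y * (z * x)
  x[yz]≡y[zx] = solve-∀

elementary : ∀ {k} → Vect k → Fin k → Matrix k
elementary w p i j = δ i j + w i * δ p j

·-elementary : ∀ {k} (w : Vect k) p (v : Vect k) i → (elementary w p · v) i ≡ v i + w i * v p
·-elementary {k} w p v i = begin
  sumFin k (λ j → (δ i j + w i * δ p j) * v j)
    ≡⟨ sumFin-cong k (λ j → distrib (δ i j) (w i) (δ p j) (v j)) ⟩
  sumFin k (λ j → δ i j * v j + w i * (δ p j * v j))
    ≡⟨ sumFin-+ k _ _ ⟩
  sumFin k (λ j → δ i j * v j) + sumFin k (λ j → w i * (δ p j * v j))
    ≡⟨ cong₂ _+_ (sumFin-δˡ k i v) (trans (sym (*-distribˡ-sumFin k (w i) _)) (cong (w i *_) (sumFin-δˡ k p v))) ⟩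
  v i + w i * v p ∎
  where
  open ≡-Reasoning
  distrib : ∀ a b c d → (a + b * c) * d ≡ a * d + b * (c * d)
  distrib = solve-∀

permutationMatrix : ∀ {k} → (Fin k → Fin k) → Matrix k
permutationMatrix π i j = δ (π i) j

·-permutationMatrix : ∀ {k} (π : Fin k → Fin k) (v : Vect k) i → (permutationMatrix π · v) i ≡ v (π i)
·-permutationMatrix {k} π v i = sumFin-δˡ k (π i) v

transpose-matchˡ : ∀ {k} (s t : Fin k) → transpose s t s ≡ t
transpose-matchˡ s t rewrite dec-true (s Finₚ.≟ s) refl = refl

transpose-other : ∀ {k} {s t x : Fin k} → x ≢ s → x ≢ t → transpose s t x ≡ x
transpose-other {s = s} {t} {x} x≢s x≢t rewrite dec-false (x Finₚ.≟ s) x≢s | dec-false (x Finₚ.≟ t) x≢t = refl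

module Congruence (q : ℕ) {{_ : NonZero q}} where

  infix 4 _≈_
  _≈_ : ℕ → ℕ → Set
  a ≈ b = a ≡[ q ] b

  ≈-setoid : Setoid 0ℓ 0ℓ
  ≈-setoid = On.setoid (≡.setoid ℕ) (_% q)

  open Setoid ≈-setoid public using () renaming (refl to ≈-refl; sym to ≈-sym; trans to ≈-trans; reflexive to ≡⇒≈)
  module ≈-Reasoning = SetoidReasoning ≈-setoid

  +-cong : ∀ {a a′ b b′} → a ≈ a′ → b ≈ b′ → a + b ≈ a′ + b′
  +-cong {a} {a′} {b} {b′} a≈a′ b≈b′ = begin
    (a + b) % q              ≡⟨ %-distribˡ-+ a b q ⟩
    (a % q + b % q) % q      ≡⟨ cong₂ (λ x y → (x + y) % q) a≈a′ b≈b′ ⟩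
    (a′ % q + b′ % q) % q    ≡⟨ %-distribˡ-+ a′ b′ q ⟨
    (a′ + b′) % q            ∎
    where open ≡-Reasoning

  *-cong : ∀ {a a′ b b′} → a ≈ a′ → b ≈ b′ → a * b ≈ a′ * b′
  *-cong {a} {a′} {b} {b′} a≈a′ b≈b′ = begin
    (a * b) % q              ≡⟨ %-distribˡ-* a b q ⟩
    (a % q * (b % q)) % q    ≡⟨ cong₂ (λ x y → (x * y) % q) a≈a′ b≈b′ ⟩
    (a′ % q * (b′ % q)) % q  ≡⟨ %-distribˡ-* a′ b′ q ⟨
    (a′ * b′) % q            ∎
    where open ≡-Reasoning

  *-congˡ : ∀ c {b b′} → b ≈ b′ → c * b ≈ c * b′
  *-congˡ c = *-cong (≈-refl {c})

  %-≈ : ∀ a → a % q ≈ a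
  %-≈ a = m%n%n≡m%n a q

  0%q≡0 : 0 % q ≡ 0
  0%q≡0 = m*n%n≡0 0 q

  +-*q-≈ : ∀ a m → a + m * q ≈ a
  +-*q-≈ a m = [m+kn]%n≡m%n a m q

  sumFin-cong≈ : ∀ n {f g : Fin n → ℕ} → (∀ i → f i ≈ g i) → sumFin n f ≈ sumFin n g
  sumFin-cong≈ zero    f≈g = refl
  sumFin-cong≈ (suc n) f≈g = +-cong (f≈g zero) (sumFin-cong≈ n (f≈g ∘ suc))

  ·-cong≈ : ∀ {k} (M : Matrix k) {v w : Vect k} → (∀ j → v j ≈ w j) → ∀ i → (M · v) i ≈ (M · w) i
  ·-cong≈ {k} M v≈w i = sumFin-cong≈ k (λ j → *-congˡ (M i j) (v≈w j))

  ≡+*q⇒≈ : ∀ {a b} m n → a + m * q ≡ b + n * q → a ≈ b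
  ≡+*q⇒≈ {a} {b} m n eq = ≈-trans (≈-sym (+-*q-≈ a m)) (≈-trans (≡⇒≈ eq) (+-*q-≈ b n))

  suc[q∸1]≡q : suc (q ∸ 1) ≡ q
  suc[q∸1]≡q = suc-pred q

  -- (q ∸ 1) * x represents − x.
  neg : ℕ → ℕ
  neg x = (q ∸ 1) * x

  +-neg≈0 : ∀ x → x + neg x ≈ 0
  +-neg≈0 x = ≡+*q⇒≈ 0 x (begin
    x + (q ∸ 1) * x + 0  ≡⟨ lemma x (q ∸ 1) ⟩
    suc (q ∸ 1) * x      ≡⟨ cong (_* x) suc[q∸1]≡q ⟩
    q * x                ≡⟨ *-comm q x ⟩
    x * q                ∎)
    where
    open ≡-Reasoning
    lemma : ∀ x Q → x + Q * x + 0 ≡ suc Q * x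
    lemma = solve-∀

  Inverses : ∀ {k} → Matrix k → Matrix k → Set
  Inverses {k} M N = (∀ (v : Vect k) i → (M · (N · v)) i ≈ v i) × (∀ (v : Vect k) i → (N · (M · v)) i ≈ v i)

  inverses⇒invertible : ∀ {k} {M N : Matrix k} → Inverses M N → Invertible q M
  inverses⇒invertible {k} {M} {N} (MN≈id , NM≈id) = N , product≈δ M N MN≈id , product≈δ N M NM≈id
    where
    product≈δ : ∀ A B → (∀ v i → (A · (B · v)) i ≈ v i) → ∀ i j → sumFin k (λ l → A i l * B l j) ≈ δ i j
    product≈δ A B AB≈id i j = begin
      sumFin k (λ l → A i l * B l j)  ≡⟨ sumFin-cong k (λ l → cong (A i l *_) (sumFin-δʳ k j (B l))) ⟨
      (A · (B · δ j)) i               ≈⟨ AB≈id (δ j) i ⟩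
      δ j i                           ≡⟨ δ-sym j i ⟩
      δ i j                           ∎
      where open ≈-Reasoning

  ⊗-·-≈ : ∀ {k} (A B : Matrix k) {v w : Vect k} → (∀ j → (B · v) j ≈ w j) → ∀ i → ((A ⊗ B) · v) i ≈ (A · w) i
  ⊗-·-≈ A B {v} Bv≈w i = ≈-trans (≡⇒≈ (·-⊗ A B v i)) (·-cong≈ A Bv≈w i)

  inverses-δ : ∀ {k} → Inverses {k} δ δ
  inverses-δ {k} = δδ≈id , δδ≈id
    where
    δδ≈id : ∀ v i → (δ · (δ · v)) i ≈ v i
    δδ≈id v i = ≡⇒≈ (trans (sumFin-δˡ k i _) (sumFin-δˡ k i v))

  inverses-⊗ : ∀ {k} {A A′ B B′ : Matrix k} → Inverses A A′ → Inverses B B′ → Inverses (A ⊗ B) (B′ ⊗ A′)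
  inverses-⊗ {A = A} {A′} {B} {B′} (AA′ , A′A) (BB′ , B′B) =
    (λ v → composite A B B′ A′ (λ w j → BB′ w j) (λ i → AA′ v i))
    , (λ v → composite B′ A′ A B (λ w j → A′A w j) (λ i → B′B v i))
    where
    composite : ∀ C D D′ C′ {v} → (∀ w j → (D · (D′ · w)) j ≈ w j) → (∀ i → (C · (C′ · v)) i ≈ v i) →
                ∀ i → ((C ⊗ D) · ((D′ ⊗ C′) · v)) i ≈ v i
    composite C D D′ C′ {v} DD′ CC′ i =
      ≈-trans (⊗-·-≈ C D (λ j → ≈-trans (·-cong≈ D (λ l → ≡⇒≈ (·-⊗ D′ C′ v l)) j) (DD′ (C′ · v) j)) i) (CC′ i)

  elementary-inverse : ∀ {k} (w w′ : Vect k) p → (∀ i → w′ i + w i + w′ p * w i ≈ 0) →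
    ∀ v i → (elementary w p · (elementary w′ p · v)) i ≈ v i
  elementary-inverse w w′ p w′∘w≈0 v i = begin
    (elementary w p · (elementary w′ p · v)) i
      ≡⟨ ·-elementary w p _ i ⟩
    (elementary w′ p · v) i + w i * (elementary w′ p · v) p
      ≡⟨ cong₂ (λ x y → x + w i * y) (·-elementary w′ p v i) (·-elementary w′ p v p) ⟩
    v i + w′ i * v p + w i * (v p + w′ p * v p)
      ≡⟨ lemma (v i) (v p) (w i) (w′ i) (w′ p) ⟩
    v i + v p * (w′ i + w i + w′ p * w i)
      ≈⟨ +-cong (≈-refl {v i}) (*-congˡ (v p) (w′∘w≈0 i)) ⟩
    v i + v p * 0
      ≡⟨ trans (cong (v i +_) (*-zeroʳ (v p))) (+-identityʳ (v i)) ⟩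
    v i ∎
    where
    open ≈-Reasoning
    lemma : ∀ a b c d e → a + d * b + c * (b + e * b) ≡ a + b * (d + c + e * c)
    lemma = solve-∀

  inverses-transpose : ∀ {k} (s t : Fin k) →
    Inverses (permutationMatrix (transpose s t)) (permutationMatrix (transpose t s))
  inverses-transpose s t = undo s t , undo t s
    where
    undo : ∀ s t v i → (permutationMatrix (transpose s t) · (permutationMatrix (transpose t s) · v)) i ≈ v i
    undo s t v i = ≡⇒≈ (begin
      (permutationMatrix (transpose s t) · (permutationMatrix (transpose t s) · v)) i
        ≡⟨ ·-permutationMatrix (transpose s t) _ i ⟩
      (permutationMatrix (transpose t s) · v) (transpose s t i)
        ≡⟨ ·-permutationMatrix (transpose t s) v (transpose s t i) ⟩
      v (transpose t s (transpose s t i))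
        ≡⟨ cong v (transpose-inverse t s) ⟩
      v i ∎)
      where open ≡-Reasoning

  ·-transpose-δ : ∀ {k} (s t x i : Fin k) → (permutationMatrix (transpose s t) · δ x) i ≡ δ (transpose t s x) i
  ·-transpose-δ s t x i = begin
    (permutationMatrix (transpose s t) · δ x) i        ≡⟨ ·-permutationMatrix (transpose s t) (δ x) i ⟩
    δ x (transpose s t i)                              ≡⟨ δ-injective transpose-injective x _ ⟨
    δ (transpose t s x) (transpose t s (transpose s t i)) ≡⟨ cong (δ (transpose t s x)) (transpose-inverse t s) ⟩
    δ (transpose t s x) i                              ∎
    where
    open ≡-Reasoning
    transpose-injective : Injective _≡_ _≡_ (transpose t s)
    transpose-injective {x} {y} eq =
      trans (sym (transpose-inverse s t)) (trans (cong (transpose s t) eq) (transpose-inverse s t))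

  LinIndep-tail : ∀ {k r} {W : Fin (suc r) → Vect k} → LinIndep q W → LinIndep q (W ∘ suc)
  LinIndep-tail W-indep c Σ≈0 l = W-indep (λ { zero → 0 ; (suc l) → c l }) Σ≈0 (suc l)

  InSpan-pullback : ∀ {k t} {M N : Matrix k} {W ws : Fin t → Vect k} {u : Vect k} → Inverses M N →
    (∀ l i → (M · W l) i ≈ ws l i) → InSpan q ws (M · u) → InSpan q W u
  InSpan-pullback {k} {t} {M} {N} {W} {ws} {u} (_ , NM≈id) MW≈ws (c , Mu≈) = c , λ i → begin
    u i                                                 ≈⟨ NM≈id u i ⟨
    (N · (M · u)) i                                     ≈⟨ ·-cong≈ N Mu≈ i ⟩
    (N · (λ j → sumFin t (λ l → c l * ws l j))) i
      ≈⟨ ·-cong≈ N (λ j → sumFin-cong≈ t (λ l → *-congˡ (c l) (≈-sym (MW≈ws l j)))) i ⟩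
    (N · (λ j → sumFin t (λ l → c l * (M · W l) j))) i  ≡⟨ ·-linear N c (λ l → M · W l) i ⟩
    sumFin t (λ l → c l * (N · (M · W l)) i)            ≈⟨ sumFin-cong≈ t (λ l → *-congˡ (c l) (NM≈id (W l) i)) ⟩
    sumFin t (λ l → c l * W l i)                        ∎
    where open ≈-Reasoning

  InSpan-unitVectors : ∀ {k r} {σ : Fin r → Fin k} → Injective _≡_ _≡_ σ → (u : Vect k) →
    (∀ i → ¬ (∃ λ l → σ l ≡ i) → u i ≈ 0) → InSpan q (λ l → δ (σ l)) u
  InSpan-unitVectors {k} {r} {σ} σ-inj u vanishes = u ∘ σ , λ i → coordinate i (Finₚ.any? (λ l → σ l Finₚ.≟ i))
    where
    coordinate : ∀ i → Dec (∃ λ l → σ l ≡ i) → u i ≈ sumFin r (λ l → u (σ l) * δ (σ l) i)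
    coordinate i (yes (l₀ , refl)) = ≡⇒≈ (sym (trans
      (sumFin-cong r (λ l → cong (u (σ l) *_) (trans (δ-sym (σ l) (σ l₀)) (δ-injective σ-inj l₀ l))))
      (sumFin-δʳ r l₀ (u ∘ σ))))
    coordinate i (no i∉σ) = ≈-trans (vanishes i i∉σ)
      (≡⇒≈ (sym (sumFin-*-vanishing r (u ∘ σ) (λ l → δ (σ l) i) (λ l → δ-≢ (λ σl≡i → i∉σ (l , σl≡i))))))

  InSpan-· : ∀ {k t} (M : Matrix k) {vs : Fin t → Vect k} {u : Vect k} →
    InSpan q vs u → InSpan q (λ j → M · vs j) (M · u)
  InSpan-· {t = t} M {vs} {u} (c , u≈) = c , λ i →
    ≈-trans (·-cong≈ M u≈ i) (≡⇒≈ (·-linear M c vs i))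

  InSpan-vanishing : ∀ {k t} {vs : Fin t → Vect k} {u : Vect k} {i} →
    InSpan q vs u → (∀ j → vs j i ≈ 0) → u i ≈ 0
  InSpan-vanishing {t = t} {vs} {u} {i} (c , u≈) vs≈0 = begin
    u i                            ≈⟨ u≈ i ⟩
    sumFin t (λ j → c j * vs j i)  ≈⟨ sumFin-cong≈ t (λ j → *-congˡ (c j) (vs≈0 j)) ⟩
    sumFin t (λ j → c j * 0)       ≡⟨ sumFin-*-vanishing t c (λ _ → 0) (λ _ → refl) ⟩
    0                              ∎
    where open ≈-Reasoning

  InSpan-nonvanishing : ∀ {k t} {vs : Fin t → Vect k} {u : Vect k} {i} →
    InSpan q vs u → ¬ u i ≈ 0 → ∃ λ j → ¬ vs j i ≈ 0
  InSpan-nonvanishing {vs = vs} {i = i} u∈span ui≉0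
    with Finₚ.any? (λ j → ¬? (vs j i % q Data.Nat.≟ 0 % q))
  ... | yes witness = witness
  ... | no none = ⊥-elim (ui≉0 (InSpan-vanishing u∈span
          (λ j → decidable-stable (vs j i % q Data.Nat.≟ 0 % q) (λ vsji≉0 → none (j , vsji≉0)))))

  SpanDim-embed : ∀ {k₀ k t r} (ι : Fin k₀ → Fin k) {vs : Fin t → Vect k₀} {vs′ : Fin t → Vect k} →
    (∀ j i → vs′ j (ι i) ≡ vs j i) → (∀ j i′ → ¬ (∃ λ i → ι i ≡ i′) → vs′ j i′ ≡ 0) →
    SpanDim q vs r → SpanDim q vs′ r
  SpanDim-embed {k₀} {k} {t} {r} ι {vs} {vs′} restrict vanish (ws , ws-indep , ws∈span , vs∈span) =
    W , W-indep , (λ l → c l , λ _ → ≈-refl) , vs′∈span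
    where
    c : Fin r → Fin t → ℕ
    c l = proj₁ (ws∈span l)
    W : Fin r → Vect k
    W l i′ = sumFin t (λ j → c l j * vs′ j i′)

    W∘ι≈ws : ∀ l i → W l (ι i) ≈ ws l i
    W∘ι≈ws l i = ≈-trans (≡⇒≈ (sumFin-cong t (λ j → cong (c l j *_) (restrict j i)))) (≈-sym (proj₂ (ws∈span l) i))

    W-indep : LinIndep q W
    W-indep d Σ≈0 = ws-indep d (λ i →
      ≈-trans (sumFin-cong≈ r (λ l → *-congˡ (d l) (≈-sym (W∘ι≈ws l i)))) (Σ≈0 (ι i)))

    vs′∈span : ∀ j → InSpan q W (vs′ j)
    vs′∈span j = a , λ i′ → coordinate i′ (Finₚ.any? (λ i → ι i Finₚ.≟ i′))
      where
      a = proj₁ (vs∈span j)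
      coordinate : ∀ i′ → Dec (∃ λ i → ι i ≡ i′) → vs′ j i′ ≈ sumFin r (λ l → a l * W l i′)
      coordinate _ (yes (i , refl)) = begin
        vs′ j (ι i)                        ≡⟨ restrict j i ⟩
        vs j i                             ≈⟨ proj₂ (vs∈span j) i ⟩
        sumFin r (λ l → a l * ws l i)      ≈⟨ sumFin-cong≈ r (λ l → *-congˡ (a l) (≈-sym (W∘ι≈ws l i))) ⟩
        sumFin r (λ l → a l * W l (ι i))   ∎
        where open ≈-Reasoning
      coordinate i′ (no i′∉ι) = ≡⇒≈ (trans (vanish j i′ i′∉ι) (sym (sumFin-*-vanishing r a (λ l → W l i′)
        (λ l → sumFin-*-vanishing t (c l) (λ j′ → vs′ j′ i′) (λ j′ → vanish j′ i′ i′∉ι)))))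

prime⇒>1 : ∀ {p} → Prime p → 1 < p
prime⇒>1 {p} p-prime = nonTrivial⇒n>1 p {{prime⇒nonTrivial p-prime}}

module PrimeField (q : ℕ) {{_ : NonZero q}} (q-prime : Prime q) where

  open Congruence q public

  1≉0 : ¬ 1 ≈ 0
  1≉0 1≈0 with trans (sym (m<n⇒m%n≡m (prime⇒>1 q-prime))) (trans 1≈0 0%q≡0)
  ... | ()

  inverse : ∀ u → ¬ u ≈ 0 → ∃ λ a → a * u ≈ 1
  inverse u u≉0 = fromBézout (coprime-Bézout (prime⇒coprime q-prime {{≢-nonZero u%q≢0}} (m%n<n u q)))
    where
    u%q≢0 : u % q ≢ 0
    u%q≢0 u%q≡0 = u≉0 (trans u%q≡0 (sym 0%q≡0))
    u′ = u % q
    fromBézout : Bézout.Identity 1 q u′ → ∃ λ a → a * u ≈ 1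
    fromBézout (Bézout.-+ x y 1+xq≡yu′) =
      y , ≈-trans (*-congˡ y (≈-sym (%-≈ u))) (≡+*q⇒≈ 0 x (trans (+-identityʳ _) (sym 1+xq≡yu′)))
    fromBézout (Bézout.+- x y 1+yu′≡xq) =
      neg y , ≈-trans (*-congˡ (neg y) (≈-sym (%-≈ u))) (≡+*q⇒≈ 1 (neg x) (begin
        neg y * u′ + 1 * q          ≡⟨ cong (λ z → neg y * u′ + 1 * z) suc[q∸1]≡q ⟨
        neg y * u′ + 1 * suc (q ∸ 1) ≡⟨ lemma (q ∸ 1) y u′ ⟩
        1 + (q ∸ 1) * (1 + y * u′)  ≡⟨ cong (λ z → 1 + (q ∸ 1) * z) 1+yu′≡xq ⟩
        1 + (q ∸ 1) * (x * q)       ≡⟨ cong (1 +_) (*-assoc (q ∸ 1) x q) ⟨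
        1 + neg x * q               ∎))
      where
      open ≡-Reasoning
      lemma : ∀ Q y u′ → Q * y * u′ + 1 * suc Q ≡ 1 + Q * (1 + y * u′)
      lemma = solve-∀

  -- Once a unit m is replaced by 1 and q by 0, the identities below become semiring identities.
  ≈-by-unit : ∀ {P X Y m R} Z → P ≡ X + m * Y → m ≈ 1 → X + Y ≡ R + Z * q → P ≈ R
  ≈-by-unit {P} {X} {Y} {m} {R} Z P≡X+mY m≈1 X+Y≡R+Zq = begin
    P          ≡⟨ P≡X+mY ⟩
    X + m * Y  ≈⟨ +-cong (≈-refl {X}) (*-cong m≈1 (≈-refl {Y})) ⟩
    X + 1 * Y  ≡⟨ cong (X +_) (*-identityˡ Y) ⟩
    X + Y      ≡⟨ X+Y≡R+Zq ⟩
    R + Z * q  ≈⟨ +-*q-≈ R Z ⟩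
    R          ∎
    where open ≈-Reasoning

  *suc[q∸1] : ∀ z → z * suc (q ∸ 1) ≡ z * q
  *suc[q∸1] z = cong (z *_) suc[q∸1]≡q

  -- With a = (u p)⁻¹ and Q = q ∸ 1 standing for −1, the elementary matrix I + (a eₚ − a u) eₚᵀ
  -- sends u to eₚ and fixes every other unit vector; its inverse is I + (u − eₚ) eₚᵀ.
  module Clearing {k} (u : Vect k) (p : Fin k) (u[p]≉0 : ¬ u p ≈ 0) where

    a = proj₁ (inverse (u p) u[p]≉0)
    a*up≈1 = proj₂ (inverse (u p) u[p]≉0)
    Q = q ∸ 1
    wT wS : Vect k
    wT i = δ p i * a + Q * (a * u i)
    wS i = u i + Q * δ p i

    clear clear⁻¹ : Matrix k
    clear   = elementary wT p
    clear⁻¹ = elementary wS p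

    wT-wS-cancel : ∀ i → wS i + wT i + wS p * wT i ≈ 0
    wT-wS-cancel i rewrite δ-refl p =
      ≈-by-unit (U + d + d * a + Q * a * U) (l₁ U d a V Q) a*up≈1
        (trans (l₂ U d a Q) (cong (0 +_) (*suc[q∸1] (U + d + d * a + Q * a * U))))
      where
      U = u i
      d = δ p i
      V = u p
      l₁ : ∀ U d a V Q → (U + Q * d) + (d * a + Q * (a * U)) + (V + Q * 1) * (d * a + Q * (a * U))
                ≡ (U + Q * d + d * a + Q * a * U + Q * (d * a + Q * a * U)) + (a * V) * (d + Q * U)
      l₁ = solve-∀
      l₂ : ∀ U d a Q → (U + Q * d + d * a + Q * a * U + Q * (d * a + Q * a * U)) + (d + Q * U)
                ≡ 0 + (U + d + d * a + Q * a * U) * suc Q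
      l₂ = solve-∀

    wS-wT-cancel : ∀ i → wT i + wS i + wT p * wS i ≈ 0
    wS-wT-cancel i rewrite δ-refl p =
      ≈-by-unit (d * a + a * U + U + Q * d) (l₁ U d a V Q) a*up≈1
        (trans (l₂ U d a Q) (cong (0 +_) (*suc[q∸1] (d * a + a * U + U + Q * d))))
      where
      U = u i
      d = δ p i
      V = u p
      l₁ : ∀ U d a V Q → (d * a + Q * (a * U)) + (U + Q * d) + (1 * a + Q * (a * V)) * (U + Q * d)
                ≡ (d * a + Q * a * U + U + Q * d + a * (U + Q * d)) + (a * V) * (Q * (U + Q * d))
      l₁ = solve-∀
      l₂ : ∀ U d a Q → (d * a + Q * a * U + U + Q * d + a * (U + Q * d)) + (Q * (U + Q * d))
                ≡ 0 + (d * a + a * U + U + Q * d) * suc Q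
      l₂ = solve-∀

    clear-inverses : Inverses clear clear⁻¹
    clear-inverses = elementary-inverse wT wS p wT-wS-cancel , elementary-inverse wS wT p wS-wT-cancel

    clear-u : ∀ i → (clear · u) i ≈ δ p i
    clear-u i = ≈-by-unit U (trans (·-elementary wT p u i) (l₁ U d a V Q)) a*up≈1
                (trans (l₂ U d Q) (cong (d +_) (*suc[q∸1] U)))
      where
      U = u i
      d = δ p i
      V = u p
      l₁ : ∀ U d a V Q → U + (d * a + Q * (a * U)) * V ≡ U + (a * V) * (d + Q * U)
      l₁ = solve-∀
      l₂ : ∀ U d Q → U + (d + Q * U) ≡ d + U * suc Q
      l₂ = solve-∀

    clear-δ : ∀ t → t ≢ p → ∀ i → (clear · δ t) i ≡ δ t i
    clear-δ t t≢p i = begin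
      (clear · δ t) i            ≡⟨ ·-elementary wT p (δ t) i ⟩
      δ t i + wT i * δ t p       ≡⟨ cong (λ z → δ t i + wT i * z) (δ-≢ t≢p) ⟩
      δ t i + wT i * 0           ≡⟨ trans (cong (δ t i +_) (*-zeroʳ (wT i))) (+-identityʳ _) ⟩
      δ t i                      ∎
      where open ≡-Reasoning

  LinIndep⇒head∉span : ∀ {k r} {W : Fin (suc r) → Vect k} → LinIndep q W → ¬ InSpan q (W ∘ suc) (W zero)
  LinIndep⇒head∉span {k} {r} {W} W-indep (c , W₀≈) = 1≉0 (W-indep d Σ≈0 zero)
    where
    d : Fin (suc r) → ℕ
    d zero    = 1
    d (suc l) = neg (c l)
    Σ≈0 : ∀ i → sumFin (suc r) (λ l → d l * W l i) ≈ 0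
    Σ≈0 i = begin
      1 * W zero i + sumFin r (λ l → neg (c l) * W (suc l) i)
        ≈⟨ +-cong (≈-trans (≡⇒≈ (*-identityˡ _)) (W₀≈ i)) ≈-refl ⟩
      sumFin r (λ l → c l * W (suc l) i) + sumFin r (λ l → neg (c l) * W (suc l) i)
        ≡⟨ sumFin-+ r _ _ ⟨
      sumFin r (λ l → c l * W (suc l) i + neg (c l) * W (suc l) i)
        ≡⟨ sumFin-cong r (λ l → *-distribʳ-+ (W (suc l) i) (c l) _) ⟨
      sumFin r (λ l → (c l + neg (c l)) * W (suc l) i)
        ≈⟨ sumFin-cong≈ r (λ l → *-cong (+-neg≈0 (c l)) ≈-refl) ⟩
      sumFin r (λ _ → 0)
        ≡⟨ sumFin-zero r ⟩
      0 ∎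
      where open ≈-Reasoning

  Pivot : ∀ {k r} → Vect k → (Fin r → Fin k) → Fin k → Set
  Pivot u σ p = ¬ (∃ λ l → σ l ≡ p) × ¬ u p ≈ 0

  pivot? : ∀ {k r} (u : Vect k) (σ : Fin r → Fin k) → Dec (∃ (Pivot u σ))
  pivot? u σ = Finₚ.any? (λ p → ¬? (Finₚ.any? (λ l → σ l Finₚ.≟ p)) ×-dec ¬? (u p % q Data.Nat.≟ 0 % q))

  ¬pivot⇒vanishes : ∀ {k r} (u : Vect k) (σ : Fin r → Fin k) → ¬ ∃ (Pivot u σ) →
    ∀ i → ¬ (∃ λ l → σ l ≡ i) → u i ≈ 0
  ¬pivot⇒vanishes u σ no-pivot i i∉σ =
    decidable-stable (u i % q Data.Nat.≟ 0 % q) (λ ui≉0 → no-pivot (i , i∉σ , ui≉0))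

  extendByPivot : ∀ {r k} {W : Fin (suc r) → Vect k} {σ : Fin (suc r) → Fin k} → Injective _≡_ _≡_ σ →
    ∀ {M′ N′} → Inverses M′ N′ → (∀ l i → (M′ · W (suc l)) i ≈ δ (σ (suc l)) i) →
    ∃ (Pivot (M′ · W zero) (σ ∘ suc)) →
    ∃₂ λ M N → Inverses M N × (∀ l i → (M · W l) i ≈ δ (σ l) i)
  extendByPivot {W = W} {σ} σ-inj {M′} {N′} M′N′ M′W≈δ (p , p∉σ′ , u[p]≉0) =
    P ⊗ (T ⊗ M′) , (N′ ⊗ T⁻¹) ⊗ P⁻¹
    , inverses-⊗ {A = P} {P⁻¹} {T ⊗ M′} {N′ ⊗ T⁻¹} (inverses-transpose (σ zero) p)
        (inverses-⊗ {A = T} {T⁻¹} {M′} {N′} clear-inverses M′N′)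
    , MW≈δ
    where
    open Clearing (M′ · W zero) p u[p]≉0 using (clear-inverses; clear-u; clear-δ)
      renaming (clear to T; clear⁻¹ to T⁻¹)
    P P⁻¹ : Matrix _
    P   = permutationMatrix (transpose (σ zero) p)
    P⁻¹ = permutationMatrix (transpose p (σ zero))

    M·≈ : ∀ w i → ((P ⊗ (T ⊗ M′)) · w) i ≈ (P · (T · (M′ · w))) i
    M·≈ w i = ⊗-·-≈ P (T ⊗ M′) (λ j → ≡⇒≈ (·-⊗ T M′ w j)) i

    MW≈δ : ∀ l i → ((P ⊗ (T ⊗ M′)) · W l) i ≈ δ (σ l) i
    MW≈δ zero i = begin
      ((P ⊗ (T ⊗ M′)) · W zero) i    ≈⟨ M·≈ (W zero) i ⟩
      (P · (T · (M′ · W zero))) i    ≈⟨ ·-cong≈ P clear-u i ⟩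
      (P · δ p) i                    ≡⟨ ·-transpose-δ (σ zero) p p i ⟩
      δ (transpose p (σ zero) p) i   ≡⟨ cong (λ x → δ x i) (transpose-matchˡ p (σ zero)) ⟩
      δ (σ zero) i                   ∎
      where open ≈-Reasoning
    MW≈δ (suc l) i = begin
      ((P ⊗ (T ⊗ M′)) · W (suc l)) i          ≈⟨ M·≈ (W (suc l)) i ⟩
      (P · (T · (M′ · W (suc l)))) i          ≈⟨ ·-cong≈ P (·-cong≈ T (M′W≈δ l)) i ⟩
      (P · (T · δ (σ (suc l)))) i             ≈⟨ ·-cong≈ P (λ j → ≡⇒≈ (clear-δ (σ (suc l)) σl≢p j)) i ⟩
      (P · δ (σ (suc l))) i                   ≡⟨ ·-transpose-δ (σ zero) p (σ (suc l)) i ⟩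
      δ (transpose p (σ zero) (σ (suc l))) i  ≡⟨ cong (λ x → δ x i) (transpose-other σl≢p σl≢σ0) ⟩
      δ (σ (suc l)) i                         ∎
      where
      open ≈-Reasoning
      σl≢p : σ (suc l) ≢ p
      σl≢p eq = p∉σ′ (l , eq)
      σl≢σ0 : σ (suc l) ≢ σ zero
      σl≢σ0 eq with σ-inj eq
      ... | ()

  -- Gaussian elimination: once W ∘ suc is sent to the unit vectors at σ ∘ suc, the image of
  -- W zero has a nonzero coordinate outside σ ∘ suc, since otherwise W zero ∈ span (W ∘ suc).
  LinIndep⇒unitVectors : ∀ r {k} (W : Fin r → Vect k) → LinIndep q W → (σ : Fin r → Fin k) → Injective _≡_ _≡_ σ →
    ∃₂ λ M N → Inverses M N × (∀ l i → (M · W l) i ≈ δ (σ l) i)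
  LinIndep⇒unitVectors zero    W _ σ _ = δ , δ , inverses-δ , λ ()
  LinIndep⇒unitVectors (suc r) W W-indep σ σ-inj =
    extend (LinIndep⇒unitVectors r (W ∘ suc) (LinIndep-tail {W = W} W-indep) (σ ∘ suc) σ′-inj)
    where
    σ′-inj : Injective _≡_ _≡_ (σ ∘ suc)
    σ′-inj eq = Finₚ.suc-injective (σ-inj eq)
    extend : (∃₂ λ M′ N′ → Inverses M′ N′ × (∀ l i → (M′ · W (suc l)) i ≈ δ (σ (suc l)) i)) →
             ∃₂ λ M N → Inverses M N × (∀ l i → (M · W l) i ≈ δ (σ l) i)
    extend (M′ , N′ , M′N′ , M′W≈δ) with pivot? (M′ · W zero) (σ ∘ suc)
    ... | yes p = extendByPivot {W = W} σ-inj {M′} {N′} M′N′ M′W≈δ p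
    ... | no no-pivot = ⊥-elim (LinIndep⇒head∉span {W = W} W-indep (InSpan-pullback {M = M′} {N′} M′N′ M′W≈δ
          (InSpan-unitVectors σ′-inj (M′ · W zero) (¬pivot⇒vanishes (M′ · W zero) (σ ∘ suc) no-pivot))))

infix 4 _^_∥_
record _^_∥_ (p e n : ℕ) : Set where
  constructor ∥-intro
  field
    cofactor      : ℕ
    decomposition : n ≡ p ^ e * cofactor
    ∤-cofactor    : ¬ p ∣ cofactor

∥⇒≢0 : ∀ {p e n} → 1 < p → p ^ e ∥ n → n ≢ 0
∥⇒≢0 {p} {e} 1<p (∥-intro m n≡pᵉm p∤m) n≡0 with m*n≡0⇒m≡0∨n≡0 (p ^ e) (trans (sym n≡pᵉm) n≡0)
... | inj₁ pᵉ≡0 = m<n⇒n≢0 1<p (m^n≡0⇒m≡0 p e pᵉ≡0)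
... | inj₂ refl = p∤m (p ∣0)

∥-coprime : ∀ {p n} → ¬ p ∣ n → p ^ 0 ∥ n
∥-coprime {n = n} p∤n = ∥-intro n (sym (*-identityˡ n)) p∤n

∥-valAux : ∀ f {p n} → 1 < p → n ≢ 0 → n ≤ f → p ^ valAux f p n ∥ n
∥-valAux zero    1<p n≢0 n≤0 = ⊥-elim (n≢0 (n≤0⇒n≡0 n≤0))
∥-valAux (suc f) {p} {n} 1<p n≢0 n≤1+f with p ≤? 1 | n Data.Nat.≟ 0 | p ∣? n
... | yes p≤1 | _       | _     = ⊥-elim (<⇒≱ 1<p p≤1)
... | no _    | yes n≡0 | _     = ⊥-elim (n≢0 n≡0)
... | no _    | no _    | no p∤n = ∥-coprime p∤n
... | no _    | no _    | yes (divides m n≡mp) with ∥-valAux f 1<p m≢0 m≤f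
  where
  m≢0 : m ≢ 0
  m≢0 m≡0 = n≢0 (trans n≡mp (cong (_* p) m≡0))
  m≤f : m ≤ f
  m≤f = ≤-pred (≤-trans (subst (m <_) (sym n≡mp) (m<m*n m p {{≢-nonZero m≢0}} 1<p)) n≤1+f)
... | ∥-intro c m≡pᵉc p∤c = ∥-intro c (trans n≡mp (trans (cong (_* p) m≡pᵉc) (lemma (p ^ valAux f p m) c p))) p∤c
  where
  lemma : ∀ x c p → x * c * p ≡ p * x * c
  lemma = solve-∀

∥-val : ∀ {p n} → 1 < p → n ≢ 0 → p ^ val p n ∥ n
∥-val {n = n} 1<p n≢0 = ∥-valAux n 1<p n≢0 ≤-refl

∥-unique : ∀ {p e e′ n} → 1 < p → p ^ e ∥ n → p ^ e′ ∥ n → e ≡ e′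
∥-unique {p} {e} {e′} 1<p (∥-intro m n≡pᵉm p∤m) (∥-intro m′ n≡pᵉ′m′ p∤m′) =
  exponents-equal e e′ (trans (sym n≡pᵉm) n≡pᵉ′m′)
  where
  instance
    _ : NonZero p
    _ = ≢-nonZero (m<n⇒n≢0 1<p)
  p∣p*x*y : ∀ x y → p ∣ p * x * y
  p∣p*x*y x y = divides (x * y) (lemma p x y)
    where
    lemma : ∀ p x y → p * x * y ≡ x * y * p
    lemma = solve-∀
  exponents-equal : ∀ e e′ → p ^ e * m ≡ p ^ e′ * m′ → e ≡ e′
  exponents-equal zero    zero     eq = refl
  exponents-equal zero    (suc e′) eq = ⊥-elim (p∤m
    (subst (p ∣_) (trans (sym eq) (*-identityˡ m)) (p∣p*x*y (p ^ e′) m′)))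
  exponents-equal (suc e) zero     eq = ⊥-elim (p∤m′ (subst (p ∣_) (trans eq (*-identityˡ m′)) (p∣p*x*y (p ^ e) m)))
  exponents-equal (suc e) (suc e′) eq = cong suc (exponents-equal e e′
    (*-cancelˡ-≡ _ _ p (trans (sym (*-assoc p (p ^ e) m)) (trans eq (*-assoc p (p ^ e′) m′)))))

∥⇒val≡ : ∀ {p e n} → 1 < p → p ^ e ∥ n → val p n ≡ e
∥⇒val≡ 1<p pᵉ∥n = ∥-unique 1<p (∥-val 1<p (∥⇒≢0 1<p pᵉ∥n)) pᵉ∥n

∥-* : ∀ {p x y a b} → Prime p → p ^ x ∥ a → p ^ y ∥ b → p ^ (x + y) ∥ a * b
∥-* {p} {x} {y} p-prime (∥-intro m a≡ p∤m) (∥-intro m′ b≡ p∤m′) = ∥-intro (m * m′)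
  (trans (cong₂ _*_ a≡ b≡) (trans (lemma (p ^ x) (p ^ y) m m′) (cong (_* (m * m′)) (sym (^-distribˡ-+-* p x y)))))
  (λ p∣mm′ → [ p∤m , p∤m′ ] (euclidsLemma m m′ p-prime p∣mm′))
  where
  lemma : ∀ a b m m′ → a * m * (b * m′) ≡ a * b * (m * m′)
  lemma = solve-∀

∥-self : ∀ {p} → 1 < p → ∀ e → p ^ e ∥ p ^ e
∥-self 1<p e = ∥-intro 1 (sym (*-identityʳ _)) (λ p∣1 → <⇒≱ 1<p (∣⇒≤ p∣1))

∥-^ : ∀ {p x a} → Prime p → p ^ x ∥ a → ∀ e → p ^ (e * x) ∥ a ^ e
∥-^ p-prime pˣ∥a zero    = ∥-self (prime⇒>1 p-prime) 0
∥-^ p-prime pˣ∥a (suc e) = ∥-* p-prime pˣ∥a (∥-^ p-prime pˣ∥a e)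

prime∤prime^ : ∀ {p p′} → Prime p → Prime p′ → p ≢ p′ → ∀ e → ¬ p ∣ p′ ^ e
prime∤prime^ p-prime p′-prime p≢p′ zero    p∣1 = <⇒≱ (prime⇒>1 p-prime) (∣⇒≤ p∣1)
prime∤prime^ {p′ = p′} p-prime p′-prime p≢p′ (suc e) p∣p′ᵉ⁺¹
  with euclidsLemma p′ (p′ ^ e) p-prime p∣p′ᵉ⁺¹
... | inj₂ p∣p′ᵉ = prime∤prime^ p-prime p′-prime p≢p′ e p∣p′ᵉ
... | inj₁ p∣p′ with prime⇒irreducible p′-prime p∣p′
...   | inj₁ refl = ¬prime[1] p-prime
...   | inj₂ p≡p′ = p≢p′ p≡p′

¬∣⇒val≡0 : ∀ {p n} → 1 < p → ¬ p ∣ n → val p n ≡ 0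
¬∣⇒val≡0 1<p p∤n = ∥⇒val≡ 1<p (∥-coprime p∤n)

∣⇒val>0 : ∀ {p n} → 1 < p → n ≢ 0 → p ∣ n → 0 < val p n
∣⇒val>0 {p} {n} 1<p n≢0 p∣n with val p n | ∥-val {p} {n} 1<p n≢0
... | zero  | ∥-intro m n≡m p∤m = ⊥-elim (p∤m (subst (p ∣_) (trans n≡m (*-identityˡ m)) p∣n))
... | suc _ | _                 = s≤s z≤n

val>0⇒∣ : ∀ {p n} → 1 < p → n ≢ 0 → 0 < val p n → p ∣ n
val>0⇒∣ {p} {n} 1<p n≢0 val>0 with val p n | ∥-val {p} {n} 1<p n≢0
... | suc v | ∥-intro m n≡pᵛ⁺¹m _ = divides (p ^ v * m) (trans n≡pᵛ⁺¹m (lemma p (p ^ v) m))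
  where
  lemma : ∀ p x m → p * x * m ≡ x * m * p
  lemma = solve-∀

whenEq : ℕ → ℕ → ℕ → ℕ
whenEq p x v with p Data.Nat.≟ x
... | yes _ = v
... | no _  = 0

whenEq-≡ : ∀ p v → whenEq p p v ≡ v
whenEq-≡ p v with p Data.Nat.≟ p
... | yes _   = refl
... | no p≢p = ⊥-elim (p≢p refl)

whenEq-≢ : ∀ {p x} v → p ≢ x → whenEq p x v ≡ 0
whenEq-≢ {p} {x} v p≢x with p Data.Nat.≟ x
... | yes p≡x = ⊥-elim (p≢x p≡x)
... | no _    = refl

∥-prime^ : ∀ {p x} → Prime p → Prime x → ∀ v → p ^ whenEq p x v ∥ x ^ v
∥-prime^ {p} {x} p-prime x-prime v with p Data.Nat.≟ x
... | yes refl = ∥-self (prime⇒>1 p-prime) v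
... | no p≢x   = ∥-coprime (prime∤prime^ p-prime x-prime p≢x v)

∥-product : ∀ {p} → Prime p → ∀ (xs : List ℕ) (g e : ℕ → ℕ) → All (λ x → p ^ e x ∥ g x) xs →
  p ^ sum (map e xs) ∥ product (map g xs)
∥-product p-prime []       g e []                = ∥-self (prime⇒>1 p-prime) 0
∥-product p-prime (x ∷ xs) g e (pᵉ∥gx ∷ pᵉ∥gxs) = ∥-* p-prime pᵉ∥gx (∥-product p-prime xs g e pᵉ∥gxs)

sum-filter : ∀ {P : ℕ → Set} (P? : Decidable P) (f : ℕ → ℕ) xs → (∀ x → ¬ P x → f x ≡ 0) →
  sum (map f (filter P? xs)) ≡ sum (map f xs)
sum-filter P? f []       f≡0 = refl
sum-filter P? f (x ∷ xs) f≡0 with P? x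
... | yes _  = cong (f x +_) (sum-filter P? f xs f≡0)
... | no ¬px = trans (sum-filter P? f xs f≡0) (cong (_+ sum (map f xs)) (sym (f≡0 x ¬px)))

sum-upTo-suc : ∀ (f : ℕ → ℕ) m → sum (map f (upTo (suc m))) ≡ sum (map f (upTo m)) + f m
sum-upTo-suc f m = begin
  sum (map f (upTo (suc m)))          ≡⟨ cong (sum ∘ map f) (upTo-∷ʳ m) ⟨
  sum (map f (upTo m ++ m ∷ []))      ≡⟨ cong sum (map-++ f (upTo m) (m ∷ [])) ⟩
  sum (map f (upTo m) ++ f m ∷ [])    ≡⟨ sum-++ (map f (upTo m)) (f m ∷ []) ⟩
  sum (map f (upTo m)) + (f m + 0)    ≡⟨ cong (sum (map f (upTo m)) +_) (+-identityʳ (f m)) ⟩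
  sum (map f (upTo m)) + f m          ∎
  where open ≡-Reasoning

sum-upTo-whenEq-≮ : ∀ p (h : ℕ → ℕ) m → ¬ p < m → sum (map (λ x → whenEq p x (h x)) (upTo m)) ≡ 0
sum-upTo-whenEq-≮ p h zero    _   = refl
sum-upTo-whenEq-≮ p h (suc m) p≮1+m = trans (sum-upTo-suc _ m)
  (cong₂ _+_ (sum-upTo-whenEq-≮ p h m (p≮1+m ∘ m<n⇒m<1+n)) (whenEq-≢ (h m) (λ p≡m → p≮1+m (s≤s (≤-reflexive p≡m)))))

sum-upTo-whenEq-< : ∀ p (h : ℕ → ℕ) m → p < m → sum (map (λ x → whenEq p x (h x)) (upTo m)) ≡ h p
sum-upTo-whenEq-< p h (suc m) p<1+m = trans (sum-upTo-suc _ m) (last (m<1+n⇒m<n∨m≡n p<1+m))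
  where
  last : p < m ⊎ p ≡ m → sum (map (λ x → whenEq p x (h x)) (upTo m)) + whenEq p m (h m) ≡ h p
  last (inj₁ p<m)  = trans (cong₂ _+_ (sum-upTo-whenEq-< p h m p<m) (whenEq-≢ (h m) (λ p≡m → <-irrefl p≡m p<m)))
                           (+-identityʳ (h p))
  last (inj₂ refl) = cong₂ _+_ (sum-upTo-whenEq-≮ p h p (<-irrefl refl)) (whenEq-≡ p (h p))

^-distribʳ-* : ∀ a b n → (a * b) ^ n ≡ a ^ n * b ^ n
^-distribʳ-* a b zero    = refl
^-distribʳ-* a b (suc n) = trans (cong (a * b *_) (^-distribʳ-* a b n)) (lemma a b (a ^ n) (b ^ n))
  where
  lemma : ∀ a b x y → a * b * (x * y) ≡ a * x * (b * y)
  lemma = solve-∀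

primeDivisor : ∀ {n} → n ≢ 0 → n ≢ 1 → ∃ λ p → Prime p × p ∣ n
primeDivisor {n} n≢0 n≢1 with factorise n {{≢-nonZero n≢0}}
... | record { factors = [] ; isFactorisation = n≡1 } = ⊥-elim (n≢1 n≡1)
... | record { factors = p ∷ ps ; isFactorisation = n≡p*∏ ; factorsPrime = p-prime ∷ _ } =
  p , p-prime , divides (product ps) (trans n≡p*∏ (*-comm p (product ps)))

module RadQ (q : ℕ) {{_ : NonZero q}} where

  ∥-radq : ∀ {p n} → Prime p → n ≢ 0 → p ^ (val p n % q) ∥ radq q n
  ∥-radq {p} {n} p-prime n≢0 = subst (λ e → p ^ e ∥ radq q n) exponent
    (∥-product p-prime (primesUpTo n) (λ x → x ^ h x) (λ x → whenEq p x (h x))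
      (All.map (λ x-prime → ∥-prime^ p-prime x-prime _) (Allₚ.all-filter prime? (upTo (suc n)))))
    where
    h : ℕ → ℕ
    h x = val x n % q
    f : ℕ → ℕ
    f x = whenEq p x (h x)
    composite⇒0 : ∀ x → ¬ Prime x → f x ≡ 0
    composite⇒0 x x-composite = whenEq-≢ (h x) (λ p≡x → x-composite (subst Prime p≡x p-prime))
    exponentUpTo : Dec (p < suc n) → sum (map f (upTo (suc n))) ≡ h p
    exponentUpTo (yes p<1+n) = sum-upTo-whenEq-< p h (suc n) p<1+n
    exponentUpTo (no p≮1+n)  = trans (sum-upTo-whenEq-≮ p h (suc n) p≮1+n) (sym (begin
      val p n % q  ≡⟨ cong (_% q) (¬∣⇒val≡0 (prime⇒>1 p-prime) (λ p∣n → p≮1+n (s≤s (∣⇒≤ {{≢-nonZero n≢0}} p∣n)))) ⟩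
      0 % q        ≡⟨ m*n%n≡0 0 q ⟩
      0            ∎))
      where open ≡-Reasoning
    exponent : sum (map f (primesUpTo n)) ≡ h p
    exponent = trans (sum-filter prime? f (upTo (suc n)) composite⇒0) (exponentUpTo (p <? suc n))

  radq≢0 : ∀ {n} → n ≢ 0 → radq q n ≢ 0
  radq≢0 n≢0 = ∥⇒≢0 (prime⇒>1 prime[2]) (∥-radq prime[2] n≢0)

  val-radq : ∀ {p n} → Prime p → n ≢ 0 → val p (radq q n) ≡ val p n % q
  val-radq p-prime n≢0 = ∥⇒val≡ (prime⇒>1 p-prime) (∥-radq p-prime n≢0)

  ∣radq⇒∣ : ∀ {p n} → Prime p → n ≢ 0 → p ∣ radq q n → p ∣ n
  ∣radq⇒∣ {p} {n} p-prime n≢0 p∣radq = val>0⇒∣ 1<p n≢0 (n≢0⇒n>0 val≢0)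
    where
    1<p = prime⇒>1 p-prime
    val≢0 : val p n ≢ 0
    val≢0 val≡0 = <-irrefl (sym (trans (val-radq p-prime n≢0) (trans (cong (_% q) val≡0) (m*n%n≡0 0 q))))
                    (∣⇒val>0 1<p (radq≢0 n≢0) p∣radq)

  -- Strong induction: split off the full power of one prime divisor of n.
  perfectPower-byVal : ∀ n → n ≢ 0 → (∀ p → Prime p → val p n % q ≡ 0) → ∃ λ s → n ≡ s ^ q
  perfectPower-byVal = <-rec _ step
    where
    step : ∀ n → (∀ {m} → m < n → m ≢ 0 → (∀ p → Prime p → val p m % q ≡ 0) → ∃ λ s → m ≡ s ^ q) →
           n ≢ 0 → (∀ p → Prime p → val p n % q ≡ 0) → ∃ λ s → n ≡ s ^ q
    step n rec n≢0 q∣val with n Data.Nat.≟ 1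
    ... | yes refl = 1 , sym (^-zeroˡ q)
    ... | no n≢1 with primeDivisor n≢0 n≢1
    ... | p , p-prime , p∣n with ∥-val {p} {n} (prime⇒>1 p-prime) n≢0
    ... | ∥-intro m n≡pᵛm p∤m = p ^ t * s , (begin
      n                     ≡⟨ n≡pᵛm ⟩
      p ^ v * m             ≡⟨ cong₂ (λ a b → p ^ a * b) v≡tq m≡sᵠ ⟩
      p ^ (t * q) * s ^ q   ≡⟨ cong (_* s ^ q) (^-*-assoc p t q) ⟨
      (p ^ t) ^ q * s ^ q   ≡⟨ ^-distribʳ-* (p ^ t) s q ⟨
      (p ^ t * s) ^ q       ∎)
      where
      open ≡-Reasoning
      1<p = prime⇒>1 p-prime
      v = val p n
      t = v / q
      v≡tq : v ≡ t * q
      v≡tq = trans (m≡m%n+[m/n]*n v q) (cong (_+ t * q) (q∣val p p-prime))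
      m≢0 : m ≢ 0
      m≢0 m≡0 = n≢0 (trans n≡pᵛm (trans (cong (p ^ v *_) m≡0) (*-zeroʳ (p ^ v))))
      m<n : m < n
      m<n = subst (m <_) (trans (*-comm m (p ^ v)) (sym n≡pᵛm))
              (m<m*n m (p ^ v) {{≢-nonZero m≢0}} (^-monoʳ-< p 1<p {0} {v} (∣⇒val>0 1<p n≢0 p∣n)))
      q∣val-m : ∀ p′ → Prime p′ → val p′ m % q ≡ 0
      q∣val-m p′ p′-prime with p′ Data.Nat.≟ p
      ... | yes refl = trans (cong (_% q) (¬∣⇒val≡0 1<p p∤m)) (m*n%n≡0 0 q)
      ... | no p′≢p  = trans (cong (_% q) (sym val-n≡val-m)) (q∣val p′ p′-prime)
        where
        val-n≡val-m : val p′ n ≡ val p′ m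
        val-n≡val-m = ∥⇒val≡ (prime⇒>1 p′-prime) (subst (λ x → p′ ^ val p′ m ∥ x) (sym n≡pᵛm)
          (∥-* p′-prime (∥-coprime (prime∤prime^ p′-prime p-prime p′≢p v)) (∥-val (prime⇒>1 p′-prime) m≢0)))
      s = proj₁ (rec m<n m≢0 q∣val-m)
      m≡sᵠ = proj₂ (rec m<n m≢0 q∣val-m)

abs-^ : ∀ x n → ∣ x ℤ.^ n ∣ ≡ ∣ x ∣ ^ n
abs-^ x zero    = refl
abs-^ x (suc n) = trans (ℤₚ.abs-* x (x ℤ.^ n)) (cong (∣ x ∣ *_) (abs-^ x n))

pos-^ : ∀ s n → (ℤ.+ s) ℤ.^ n ≡ ℤ.+ (s ^ n)
pos-^ s zero    = refl
pos-^ s (suc n) = trans (cong ((ℤ.+ s) ℤ.*_) (pos-^ s n)) (sym (ℤₚ.pos-* s (s ^ n)))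

neg-^-odd : ∀ n → ¬ 2 ∣ n → ∀ y → (ℤ.- y) ℤ.^ n ≡ ℤ.- (y ℤ.^ n)
neg-^-odd zero          2∤0   y = ⊥-elim (2∤0 (divides 0 refl))
neg-^-odd (suc zero)    _     y = lemma y
  where
  lemma : ∀ y → ℤ.- y ℤ.* ℤ.+ 1 ≡ ℤ.- (y ℤ.* ℤ.+ 1)
  lemma = ℤ-Solver.solve-∀
neg-^-odd (suc (suc n)) 2∤2+n y =
  trans (cong (λ z → ℤ.- y ℤ.* (ℤ.- y ℤ.* z)) (neg-^-odd n 2∤n y)) (lemma y (y ℤ.^ n))
  where
  2∤n : ¬ 2 ∣ n
  2∤n (divides k n≡2k) = 2∤2+n (divides (suc k) (cong (λ m → suc (suc m)) n≡2k))
  lemma : ∀ y z → ℤ.- y ℤ.* (ℤ.- y ℤ.* ℤ.- z) ≡ ℤ.- (y ℤ.* (y ℤ.* z))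
  lemma = ℤ-Solver.solve-∀

∣∣≡^⇒perfectPower : ∀ {q} → ¬ 2 ∣ q → ∀ b s → ∣ b ∣ ≡ s ^ q → PerfectPower q b
∣∣≡^⇒perfectPower {q} 2∤q (ℤ.+ n)  s n≡sᵠ = ℤ.+ s , trans (cong ℤ.+_ n≡sᵠ) (sym (pos-^ s q))
∣∣≡^⇒perfectPower {q} 2∤q -[1+ n ] s 1+n≡sᵠ = ℤ.- (ℤ.+ s) , (begin
  -[1+ n ]              ≡⟨ cong (λ z → ℤ.- (ℤ.+ z)) 1+n≡sᵠ ⟩
  ℤ.- (ℤ.+ (s ^ q))     ≡⟨ cong ℤ.-_ (pos-^ s q) ⟨
  ℤ.- ((ℤ.+ s) ℤ.^ q)   ≡⟨ neg-^-odd q 2∤q (ℤ.+ s) ⟨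
  (ℤ.- (ℤ.+ s)) ℤ.^ q   ∎)
  where open ≡-Reasoning

lookup-increasing : ∀ {xs : List ℕ} → AllPairs _<_ xs → ∀ {i j} → i Fin.< j → lookup xs i < lookup xs j
lookup-increasing {x ∷ xs} (x<xs ∷ _)  {zero}  {suc j} _         = All.lookup x<xs (∈-lookup j)
lookup-increasing {x ∷ xs} (_ ∷ xs↑)   {suc i} {suc j} (s≤s i<j) = lookup-increasing xs↑ i<j

increasing⇒injective : ∀ {k} {f : Fin k → ℕ} → (∀ i j → i Fin.< j → f i < f j) → Injective _≡_ _≡_ f
increasing⇒injective {f = f} f↑ {i} {j} fi≡fj with Finₚ.<-cmp i j
... | tri< i<j _ _ = ⊥-elim (<-irrefl fi≡fj (f↑ i j i<j))
... | tri≈ _ i≡j _ = i≡j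
... | tri> _ _ j<i = ⊥-elim (<-irrefl (sym fi≡fj) (f↑ j i j<i))

record Enumeration (D : ℕ → Set) : Set where
  field
    size       : ℕ
    elem       : Fin size → ℕ
    increasing : ∀ i j → i Fin.< j → elem i < elem j
    complete   : ∀ p → D p → ∃ λ i → elem i ≡ p
    sound      : ∀ i → D (elem i)

enumerate : ∀ {D : ℕ → Set} → Decidable D → ∀ N → (∀ p → D p → p ≤ N) → Enumeration D
enumerate {D} D? N D≤N = record
  { size       = length xs
  ; elem       = lookup xs
  ; increasing = λ i j → lookup-increasing xs↑
  ; complete   = λ p Dp → let p∈xs = ∈-filter⁺ D? (∈-upTo⁺ (s≤s (D≤N p Dp))) Dp
                          in Any.index p∈xs , sym (Anyₚ.lookup-index p∈xs)
  ; sound      = λ i → proj₂ (∈-filter⁻ D? {xs = upTo (suc N)} (∈-lookup {xs = xs} i))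
  }
  where
  xs = filter D? (upTo (suc N))
  xs↑ : AllPairs _<_ xs
  xs↑ = filter⁺ D? (applyUpTo⁺₁ (λ x → x) (suc N) (λ i<j _ → i<j))

fromExponents : ∀ {k} → (Fin k → ℕ) → (Fin k → ℕ) → ℕ
fromExponents {zero}  ps e = 1
fromExponents {suc k} ps e = ps zero ^ e zero * fromExponents (ps ∘ suc) (e ∘ suc)

∥-fromExponents : ∀ {p} → Prime p → ∀ {k} (ps : Fin k → ℕ) → (∀ i → Prime (ps i)) → ∀ e →
  p ^ sumFin k (λ i → whenEq p (ps i) (e i)) ∥ fromExponents ps e
∥-fromExponents p-prime {zero}  ps ps-prime e = ∥-self (prime⇒>1 p-prime) 0
∥-fromExponents p-prime {suc k} ps ps-prime e =
  ∥-* p-prime (∥-prime^ p-prime (ps-prime zero) (e zero))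
    (∥-fromExponents p-prime (ps ∘ suc) (ps-prime ∘ suc) (e ∘ suc))

module FromExponents {k} (ps : Fin k → ℕ) (ps-prime : ∀ i → Prime (ps i)) (ps-inj : Injective _≡_ _≡_ ps) where

  whenEq-ps : ∀ i₀ i x → whenEq (ps i₀) (ps i) x ≡ δ i₀ i * x
  whenEq-ps i₀ i x with i₀ Finₚ.≟ i
  ... | yes refl = trans (whenEq-≡ (ps i₀) x) (sym (trans (cong (_* x) (δ-refl i₀)) (*-identityˡ x)))
  ... | no i₀≢i  = trans (whenEq-≢ x (i₀≢i ∘ ps-inj)) (sym (cong (_* x) (δ-≢ i₀≢i)))

  fromExponents≢0 : ∀ e → fromExponents ps e ≢ 0
  fromExponents≢0 e = ∥⇒≢0 (prime⇒>1 prime[2]) (∥-fromExponents prime[2] ps ps-prime e)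

  val-fromExponents : ∀ e i → val (ps i) (fromExponents ps e) ≡ e i
  val-fromExponents e i = ∥⇒val≡ (prime⇒>1 (ps-prime i)) (subst (λ x → ps i ^ x ∥ fromExponents ps e)
    (trans (sumFin-cong k (λ i′ → whenEq-ps i i′ (e i′))) (sumFin-δˡ k i e))
    (∥-fromExponents (ps-prime i) ps ps-prime e))

  val-fromExponents-other : ∀ {p} e → Prime p → (∀ i → ps i ≢ p) → val p (fromExponents ps e) ≡ 0
  val-fromExponents-other {p} e p-prime p∉ps = ∥⇒val≡ (prime⇒>1 p-prime) (subst (λ x → p ^ x ∥ fromExponents ps e)
    (trans (sumFin-cong k (λ i → whenEq-≢ (e i) (p∉ps i ∘ sym))) (sumFin-zero k))
    (∥-fromExponents p-prime ps ps-prime e))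

  ∣fromExponents⇒ : ∀ {p} e → Prime p → p ∣ fromExponents ps e → ∃ λ i → ps i ≡ p × e i ≢ 0
  ∣fromExponents⇒ {p} e p-prime p∣n with Finₚ.any? (λ i → ps i Data.Nat.≟ p)
  ... | yes (i , refl) = i , refl , λ eᵢ≡0 → <-irrefl (sym (trans (val-fromExponents e i) eᵢ≡0)) val>0
    where val>0 = ∣⇒val>0 (prime⇒>1 p-prime) (fromExponents≢0 e) p∣n
  ... | no p∉ps = ⊥-elim (<-irrefl (sym (val-fromExponents-other e p-prime (λ i psᵢ≡p → p∉ps (i , psᵢ≡p))))
                    (∣⇒val>0 (prime⇒>1 p-prime) (fromExponents≢0 e) p∣n))

val-^ : ∀ {p x} → Prime p → x ≢ 0 → ∀ e → val p (x ^ e) ≡ e * val p x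
val-^ p-prime x≢0 e = ∥⇒val≡ (prime⇒>1 p-prime) (∥-^ p-prime (∥-val (prime⇒>1 p-prime) x≢0) e)

0^n≡0 : ∀ n .{{_ : NonZero n}} → 0 ^ n ≡ 0
0^n≡0 (suc n) = refl

m*n<m⇒n≡0 : ∀ m n → m * n < m → n ≡ 0
m*n<m⇒n≡0 m zero    _     = refl
m*n<m⇒n≡0 m (suc n) mn<m = ⊥-elim (<⇒≱ mn<m (m≤m*n m (suc n)))

module Construction
  (q : ℕ) {{_ : NonZero q}} (q-prime : Prime q) (2∤q : ¬ 2 ∣ q)
  (B : List ℤ) (admissible-B : Admissible q B)
  {r k₀ : ℕ} (ps₀ : Fin k₀ → ℕ) (primes-B : IsPrimeList q B [] ps₀) (dim-B : SpanDim q (pointsOf q ps₀ B) r)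
  (pbar : Fin r → ℕ) (pbar-prime : ∀ l → Prime (pbar l)) (pbar-inj : Injective _≡_ _≡_ pbar)
  where

  open PrimeField q q-prime
  open RadQ q

  n : ℕ
  n = length B

  b : Fin n → ℤ
  b = lookup B

  ∣b∣≢0 : ∀ j → ∣ b j ∣ ≢ 0
  ∣b∣≢0 j ∣b∣≡0 = All.lookup (proj₁ (proj₂ admissible-B)) (∈-lookup j) (ℤₚ.∣i∣≡0⇒i≡0 ∣b∣≡0)

  primes-B⇔ : ∀ p → (Prime p × (DividesPiq q B p ⊎ DividesPiq q [] p)) ⇔ (∃ λ i → ps₀ i ≡ p)
  primes-B⇔ = proj₂ primes-B

  Relevant : ℕ → Set
  Relevant p = Prime p × ((∃ λ i → ps₀ i ≡ p) ⊎ (∃ λ l → pbar l ≡ p))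

  relevant? : Decidable Relevant
  relevant? p = prime? p ×-dec (Finₚ.any? (λ i → ps₀ i Data.Nat.≟ p) ⊎-dec Finₚ.any? (λ l → pbar l Data.Nat.≟ p))

  relevant≤ : ∀ p → Relevant p → p ≤ sumFin k₀ ps₀ + sumFin r pbar
  relevant≤ p (_ , inj₁ (i , refl)) = ≤-trans (≤-sumFin k₀ ps₀ i) (m≤m+n _ _)
  relevant≤ p (_ , inj₂ (l , refl)) = ≤-trans (≤-sumFin r pbar l) (m≤n+m _ _)

  open Enumeration (enumerate relevant? _ relevant≤) public
    renaming (size to k; elem to ps; increasing to ps-increasing; complete to ps-complete; sound to ps-sound)

  ps-prime : ∀ i → Prime (ps i)
  ps-prime i = proj₁ (ps-sound i)

  ps-inj : Injective _≡_ _≡_ ps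
  ps-inj = increasing⇒injective ps-increasing

  open FromExponents ps ps-prime ps-inj

  ps₀-prime : ∀ i → Prime (ps₀ i)
  ps₀-prime i = proj₁ (Equivalence.from (primes-B⇔ (ps₀ i)) (i , refl))

  ι : Fin k₀ → Fin k
  ι i = proj₁ (ps-complete (ps₀ i) (ps₀-prime i , inj₁ (i , refl)))

  ps∘ι : ∀ i → ps (ι i) ≡ ps₀ i
  ps∘ι i = proj₂ (ps-complete (ps₀ i) (ps₀-prime i , inj₁ (i , refl)))

  σ : Fin r → Fin k
  σ l = proj₁ (ps-complete (pbar l) (pbar-prime l , inj₂ (l , refl)))

  ps∘σ : ∀ l → ps (σ l) ≡ pbar l
  ps∘σ l = proj₂ (ps-complete (pbar l) (pbar-prime l , inj₂ (l , refl)))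

  σ-inj : Injective _≡_ _≡_ σ
  σ-inj {l} {l′} σl≡σl′ = pbar-inj (trans (sym (ps∘σ l)) (trans (cong ps σl≡σl′) (ps∘σ l′)))

  dividesPiq-B : ∀ {p} j → p ∣ radq q (∣ b j ∣) → DividesPiq q B p
  dividesPiq-B {p} j p∣radq = Any.map (λ b≡ → subst (λ x → p ∣ radq q (∣ x ∣)) b≡ p∣radq) (∈-lookup j)

  dividesPiq-B⇒ps : ∀ {p} → Prime p → DividesPiq q B p → ∃ λ i → ps i ≡ p
  dividesPiq-B⇒ps {p} p-prime p∣πB = ps-complete p
    (p-prime , inj₁ (Equivalence.to (primes-B⇔ p) (p-prime , inj₁ p∣πB)))

  v : Fin n → Vect k
  v = pointsOf q ps B

  v∘ι : ∀ j i → v j (ι i) ≡ pointsOf q ps₀ B j i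
  v∘ι j i = cong (λ p → val p (radq q (∣ b j ∣))) (ps∘ι i)

  v-vanishes : ∀ j i′ → ¬ (∃ λ i → ι i ≡ i′) → v j i′ ≡ 0
  v-vanishes j i′ i′∉ι = ¬∣⇒val≡0 (prime⇒>1 (ps-prime i′)) ps∤radq
    where
    ps∤radq : ¬ ps i′ ∣ radq q (∣ b j ∣)
    ps∤radq p∣radq with Equivalence.to (primes-B⇔ (ps i′)) (ps-prime i′ , inj₁ (dividesPiq-B j p∣radq))
    ... | i , ps₀i≡ = i′∉ι (i , ps-inj (trans (ps∘ι i) ps₀i≡))

  dim : SpanDim q v r
  dim = SpanDim-embed ι v∘ι v-vanishes dim-B

  W : Fin r → Vect k
  W = proj₁ dim

  W-indep : LinIndep q W
  W-indep = proj₁ (proj₂ dim)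

  W∈span : ∀ l → InSpan q v (W l)
  W∈span = proj₁ (proj₂ (proj₂ dim))

  v∈span : ∀ j → InSpan q W (v j)
  v∈span = proj₂ (proj₂ (proj₂ dim))

  elimination : ∃₂ λ M N → Inverses M N × (∀ l i → (M · W l) i ≈ δ (σ l) i)
  elimination = LinIndep⇒unitVectors r W W-indep σ σ-inj

  M N : Matrix k
  M = proj₁ elimination
  N = proj₁ (proj₂ elimination)

  M-inverses : Inverses M N
  M-inverses = proj₁ (proj₂ (proj₂ elimination))

  MW≈δ : ∀ l i → (M · W l) i ≈ δ (σ l) i
  MW≈δ = proj₂ (proj₂ (proj₂ elimination))

  M-invertible : Invertible q M
  M-invertible = inverses⇒invertible {M = M} {N} M-inverses

  e : Fin n → Vect k
  e j i = (M · v j) i % q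

  e-vanishes : ∀ j i → ¬ (∃ λ l → σ l ≡ i) → e j i ≡ 0
  e-vanishes j i i∉σ = trans (InSpan-vanishing (InSpan-· M (v∈span j))
    (λ l → ≈-trans (MW≈δ l i) (≡⇒≈ (δ-≢ (λ σl≡i → i∉σ (l , σl≡i)))))) 0%q≡0

  pbar-occurs : ∀ l → ∃ λ j → e j (σ l) ≢ 0
  pbar-occurs l = map₂ (λ Mv≉0 e≡0 → Mv≉0 (trans e≡0 (sym 0%q≡0)))
    (InSpan-nonvanishing {vs = λ j → M · v j} {u = M · W l} (InSpan-· M {vs = v} (W∈span l)) MWl[σl]≉0)
    where
    MWl[σl]≉0 : ¬ (M · W l) (σ l) ≈ 0
    MWl[σl]≉0 ≈0 = 1≉0 (≈-trans (≡⇒≈ (sym (δ-refl (σ l)))) (≈-trans (≈-sym (MW≈δ l (σ l))) ≈0))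

  b′ : Fin n → ℤ
  b′ j = ℤ.+ fromExponents ps (e j)

  B′ : List ℤ
  B′ = deduplicate ℤ._≟_ (tabulate b′)

  Any-B′⁺ : ∀ {P : ℤ → Set} j → P (b′ j) → Any P B′
  Any-B′⁺ j Pb′ = Anyₚ.deduplicate⁺ ℤ._≟_ (λ { refl Px → Px }) (Anyₚ.tabulate⁺ j Pb′)

  Any-B′⁻ : ∀ {P : ℤ → Set} → Any P B′ → ∃ λ j → P (b′ j)
  Any-B′⁻ P-B′ = Anyₚ.tabulate⁻ (Anyₚ.deduplicate⁻ ℤ._≟_ P-B′)

  All-B′ : ∀ {P : ℤ → Set} → (∀ j → P (b′ j)) → All P B′
  All-B′ P-b′ = Allₚ.deduplicate⁺ ℤ._≟_ (Allₚ.tabulate⁺ P-b′)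

  unique-B′ : Unique B′
  unique-B′ = deduplicate-! ℤ._≟_ (tabulate b′)

  val-radq-b′ : ∀ j i → val (ps i) (radq q (∣ b′ j ∣)) ≡ e j i
  val-radq-b′ j i = begin
    val (ps i) (radq q (fromExponents ps (e j)))  ≡⟨ val-radq (ps-prime i) (fromExponents≢0 (e j)) ⟩
    val (ps i) (fromExponents ps (e j)) % q       ≡⟨ cong (_% q) (val-fromExponents (e j) i) ⟩
    (M · v j) i % q % q                           ≡⟨ m%n%n≡m%n _ q ⟩
    e j i                                         ∎
    where open ≡-Reasoning

  ps∣radq-b′ : ∀ j i → e j i ≢ 0 → ps i ∣ radq q (∣ b′ j ∣)
  ps∣radq-b′ j i eⱼᵢ≢0 = val>0⇒∣ (prime⇒>1 (ps-prime i)) (radq≢0 (fromExponents≢0 (e j)))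
    (subst (0 <_) (sym (val-radq-b′ j i)) (n≢0⇒n>0 eⱼᵢ≢0))

  M·v≈b′ : ∀ j → SamePoint q (M · v j) (expVec q ps (b′ j))
  M·v≈b′ j = 1 , 1≉0 , λ i → ≈-trans (≈-sym (%-≈ ((M · v j) i)))
    (≡⇒≈ (trans (sym (val-radq-b′ j i)) (sym (*-identityˡ (expVec q ps (b′ j) i)))))

  image-in-B′ : ∀ j → ∃ λ j′ → SamePoint q (M · v j) (pointsOf q ps B′ j′)
  image-in-B′ j = Any.index b′∈B′ , subst (λ x → SamePoint q (M · v j) (expVec q ps x))
    (Anyₚ.lookup-index b′∈B′) (M·v≈b′ j)
    where
    b′∈B′ : b′ j ∈ B′
    b′∈B′ = Any-B′⁺ j refl

  preimage-in-B : ∀ j′ → ∃ λ j → SamePoint q (M · v j) (pointsOf q ps B′ j′)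
  preimage-in-B j′ = j , subst (λ x → SamePoint q (M · v j) (expVec q ps x)) (sym lookup≡b′) (M·v≈b′ j)
    where
    j = proj₁ (Any-B′⁻ (∈-lookup {xs = B′} j′))
    lookup≡b′ : lookup B′ j′ ≡ b′ j
    lookup≡b′ = proj₂ (Any-B′⁻ (∈-lookup {xs = B′} j′))

  e≡0⇒v≈0 : ∀ j → (∀ i → e j i ≡ 0) → ∀ i → v j i ≈ 0
  e≡0⇒v≈0 j e≡0 i = begin
    v j i                   ≈⟨ proj₂ M-inverses (v j) i ⟨
    (N · (M · v j)) i       ≈⟨ ·-cong≈ N (λ i′ → trans (e≡0 i′) (sym 0%q≡0)) i ⟩
    (N · (λ _ → 0)) i       ≡⟨ sumFin-*-vanishing k (N i) (λ _ → 0) (λ _ → refl) ⟩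
    0                       ∎
    where open ≈-Reasoning

  q∣val-b : ∀ j → (∀ i → e j i ≡ 0) → ∀ p → Prime p → val p ∣ b j ∣ % q ≡ 0
  q∣val-b j e≡0 p p-prime = byCases (Finₚ.any? (λ i → ps i Data.Nat.≟ p))
    where
    byCases : Dec (∃ λ i → ps i ≡ p) → val p ∣ b j ∣ % q ≡ 0
    byCases (yes (i , refl)) = begin
      val (ps i) ∣ b j ∣ % q      ≡⟨ m%n%n≡m%n (val (ps i) ∣ b j ∣) q ⟨
      val (ps i) ∣ b j ∣ % q % q  ≡⟨ cong (_% q) (val-radq (ps-prime i) (∣b∣≢0 j)) ⟨
      v j i % q                   ≡⟨ e≡0⇒v≈0 j e≡0 i ⟩
      0 % q                       ≡⟨ 0%q≡0 ⟩
      0                           ∎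
      where open ≡-Reasoning
    byCases (no p∉ps) = trans (sym (val-radq p-prime (∣b∣≢0 j))) (¬∣⇒val≡0 (prime⇒>1 p-prime) p∤radq)
      where
      p∤radq : ¬ p ∣ radq q (∣ b j ∣)
      p∤radq p∣radq = p∉ps (dividesPiq-B⇒ps p-prime (dividesPiq-B j p∣radq))

  perfectPower-b′⇒e≡0 : ∀ j → PerfectPower q (b′ j) → ∀ i → e j i ≡ 0
  perfectPower-b′⇒e≡0 j (x , b′≡xᵠ) i = trans eⱼᵢ≡q*val
    (trans (cong (q *_) (m*n<m⇒n≡0 q (val (ps i) ∣ x ∣)
      (subst (_< q) eⱼᵢ≡q*val (m%n<n ((M · v j) i) q)))) (*-zeroʳ q))
    where
    ∣b′∣≡∣x∣ᵠ : ∣ b′ j ∣ ≡ ∣ x ∣ ^ q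
    ∣b′∣≡∣x∣ᵠ = trans (cong ∣_∣ b′≡xᵠ) (abs-^ x q)
    ∣x∣≢0 : ∣ x ∣ ≢ 0
    ∣x∣≢0 ∣x∣≡0 = fromExponents≢0 (e j) (trans ∣b′∣≡∣x∣ᵠ (trans (cong (_^ q) ∣x∣≡0) (0^n≡0 q)))
    eⱼᵢ≡q*val : e j i ≡ q * val (ps i) ∣ x ∣
    eⱼᵢ≡q*val = begin
      e j i                      ≡⟨ val-fromExponents (e j) i ⟨
      val (ps i) ∣ b′ j ∣        ≡⟨ cong (val (ps i)) ∣b′∣≡∣x∣ᵠ ⟩
      val (ps i) (∣ x ∣ ^ q)     ≡⟨ val-^ (ps-prime i) ∣x∣≢0 q ⟩
      q * val (ps i) ∣ x ∣       ∎
      where open ≡-Reasoning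

  b′-notPerfectPower : ∀ j → ¬ PerfectPower q (b′ j)
  b′-notPerfectPower j b′-power = All.lookup (proj₂ (proj₂ admissible-B)) (∈-lookup j)
    (∣∣≡^⇒perfectPower 2∤q (b j) (proj₁ ∣b∣-power) (proj₂ ∣b∣-power))
    where
    ∣b∣-power = perfectPower-byVal ∣ b j ∣ (∣b∣≢0 j) (q∣val-b j (perfectPower-b′⇒e≡0 j b′-power))

  admissible-B′ : Admissible q B′
  admissible-B′ = unique-B′ , All-B′ (λ j b′≡0 → fromExponents≢0 (e j) (cong ∣_∣ b′≡0)) , All-B′ b′-notPerfectPower

  e≢0⇒∈σ : ∀ j i → e j i ≢ 0 → ∃ λ l → σ l ≡ i
  e≢0⇒∈σ j i eⱼᵢ≢0 = decidable-stable (Finₚ.any? (λ l → σ l Finₚ.≟ i)) (λ i∉σ → eⱼᵢ≢0 (e-vanishes j i i∉σ))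

  σ-divides-radq-b′ : ∀ l → ∃ λ j → ps (σ l) ∣ radq q (∣ b′ j ∣)
  σ-divides-radq-b′ l = map₂ (λ {j} → ps∣radq-b′ j (σ l)) (pbar-occurs l)

  dividesPiq-B′⇒ps : ∀ {p} → Prime p → DividesPiq q B′ p → ∃ λ i → ps i ≡ p
  dividesPiq-B′⇒ps {p} p-prime p∣πB′ =
    map₂ proj₁ (∣fromExponents⇒ (e j) p-prime (∣radq⇒∣ p-prime (fromExponents≢0 (e j)) p∣radq))
    where
    j = proj₁ (Any-B′⁻ {P = λ x → p ∣ radq q (∣ x ∣)} p∣πB′)
    p∣radq = proj₂ (Any-B′⁻ {P = λ x → p ∣ radq q (∣ x ∣)} p∣πB′)

  relevant⇒dividesPiq : ∀ {p} → Relevant p → DividesPiq q B p ⊎ DividesPiq q B′ p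
  relevant⇒dividesPiq {p} (_ , inj₁ (i₀ , ps₀i₀≡p)) =
    [ inj₁ , (λ ()) ]′ (proj₂ (Equivalence.from (primes-B⇔ p) (i₀ , ps₀i₀≡p)))
  relevant⇒dividesPiq {p} (_ , inj₂ (l , refl)) = inj₂ (Any-B′⁺ {P = λ x → pbar l ∣ radq q (∣ x ∣)} j
    (subst (_∣ radq q (∣ b′ j ∣)) (ps∘σ l) (proj₂ (σ-divides-radq-b′ l))))
    where j = proj₁ (σ-divides-radq-b′ l)

  primeList-B-B′ : IsPrimeList q B B′ ps
  primeList-B-B′ = ps-increasing , λ p → mk⇔ to from
    where
    to : ∀ {p} → Prime p × (DividesPiq q B p ⊎ DividesPiq q B′ p) → ∃ λ i → ps i ≡ p
    to (p-prime , inj₁ p∣πB)  = dividesPiq-B⇒ps p-prime p∣πB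
    to (p-prime , inj₂ p∣πB′) = dividesPiq-B′⇒ps p-prime p∣πB′
    from : ∀ {p} → (∃ λ i → ps i ≡ p) → Prime p × (DividesPiq q B p ⊎ DividesPiq q B′ p)
    from (i , refl) = ps-prime i , relevant⇒dividesPiq (ps-sound i)

  primeDivisors-B′ : ∀ p → (Prime p × Any (λ x → p ∣ ∣ x ∣) B′) ⇔ (∃ λ l → pbar l ≡ p)
  primeDivisors-B′ p = mk⇔ to from
    where
    to : Prime p × Any (λ x → p ∣ ∣ x ∣) B′ → ∃ λ l → pbar l ≡ p
    to (p-prime , p∣B′) = l , trans (sym (ps∘σ l)) (trans (cong ps σl≡i) psᵢ≡p)
      where
      j = proj₁ (Any-B′⁻ {P = λ x → p ∣ ∣ x ∣} p∣B′)
      exponent = ∣fromExponents⇒ (e j) p-prime (proj₂ (Any-B′⁻ {P = λ x → p ∣ ∣ x ∣} p∣B′))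
      i = proj₁ exponent
      psᵢ≡p = proj₁ (proj₂ exponent)
      l = proj₁ (e≢0⇒∈σ j i (proj₂ (proj₂ exponent)))
      σl≡i = proj₂ (e≢0⇒∈σ j i (proj₂ (proj₂ exponent)))
    from : (∃ λ l → pbar l ≡ p) → Prime p × Any (λ x → p ∣ ∣ x ∣) B′
    from (l , refl) = pbar-prime l , Any-B′⁺ {P = λ x → pbar l ∣ ∣ x ∣} j
      (subst (_∣ ∣ b′ j ∣) (ps∘σ l) (∣radq⇒∣ (ps-prime (σ l)) (fromExponents≢0 (e j)) (proj₂ (σ-divides-radq-b′ l))))
      where j = proj₁ (σ-divides-radq-b′ l)

proposition4p6 : (q : ℕ) .{{_ : NonZero q}} → Prime q → ¬ (2 ∣ q) →
    (B : List ℤ) → Admissible q B →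
    (r : ℕ) → IsDimMinusOne q B r →
    (pbar : Fin r → ℕ) → ((i : Fin r) → Prime (pbar i)) → Injective _≡_ _≡_ pbar →
    Σ (List ℤ) λ B' → GeomEquiv q B B' ×
      ((p : ℕ) → (Prime p × Any (λ b → p ∣ (∣ b ∣)) B') ⇔ (∃ λ i → pbar i ≡ p))
proposition4p6 q q-prime 2∤q B admissible-B r (k₀ , ps₀ , primes-B , dim-B) pbar pbar-prime pbar-inj =
  B′ , (admissible-B , admissible-B′ , k , ps , primeList-B-B′ , M , M-invertible , image-in-B′ , preimage-in-B)
  , primeDivisors-B′
  where
  open Construction q {{prime⇒nonZero q-prime}} q-prime 2∤q B admissible-B ps₀ primes-B dim-B pbar pbar-prime pbar-inj
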